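{- Let $k \geq 1$. For every instance of $k$-center (a finite metric space $(\mathcal{C}, d)$ with $|\mathcal{C}| = n \geq k$, together with $k$), every execution of the reverse greedy algorithm (under any tie-breaking) returns a set $F_{n-k}$ with $\mathrm{cost}(F_{n-k}) \leq 2k \cdot \mathrm{OPT}$. Moreover, there exist instances of $k$-center and executions of reverse greedy (i.e., valid tie-breaking choices) that return a solution of cost $(2k-2)\cdot \mathrm{OPT}$. That is, reverse greedy is between a $(2k-2)$-approximation and a $2k$-approximation for $k$-center.
   Context: An instance of $k$-center is a finite metric space $(\mathcal{C}, d)$ and an integer $k$; every point of $\mathcal{C}$ is both a client and a potential facility. For $c \in \mathcal{C}$ and $F \subseteq \mathcal{C}$, $d(c,F) = \min_{f\in F} d(c,f)$, and $\mathrm{cost}(F) = \max_{c \in \mathcal{C}} d(c,F)$. A solution is a set $F \subseteq \mathcal{C}$ with $|F| \leq k$, and $\mathrm{OPT}$ is the minimum cost of a solution. The reverse greedy algorithm sets $F_0 = \mathcal{C}$ and for $i = 1, \ldots, n-k$ chooses $f_i \in \arg\min_{f \in F_{i-1}} \mathrm{cost}(F_{i-1}\setminus\{f\})$ (ties broken arbitrarily) and sets $F_i = F_{i-1}\setminus\{f_i\}$; it returns $F_{n-k}$.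
   Formalization: The distances $d$ take values in the rationals rather than the reals, both for every instance covered by the 2k·OPT bound and for the instance attaining (2k−2)·OPT. -}

module Defs where

open import Data.Nat as ℕ using (ℕ; zero; suc)
open import Data.Integer using (+_)
open import Data.Rational using (ℚ; 0ℚ; _/_; _+_; _*_; _⊓_; _⊔_) renaming (_≤_ to _≤ℚ_)
open import Data.Fin using (Fin)
open import Data.Fin.Subset using (Subset; _∈_; _-_; ∣_∣; ⊤)
open import Data.Fin.Subset.Properties using (_∈?_)
open import Data.List using (List; []; _∷_; foldr; map; filter)
open import Data.List.Base using (allFin)
open import Data.Maybe using (Maybe; just; nothing)
open import Data.Unit using () renaming (⊤ to Unit)
open import Data.Empty using () renaming (⊥ to Empty)
open import Relation.Binary.PropositionalEquality using (_≡_)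

record IsMetric {n : ℕ} (d : Fin n → Fin n → ℚ) : Set where
  field
    nonneg   : ∀ x y → 0ℚ ≤ℚ d x y
    zero-iff : ∀ x y → (d x y ≡ 0ℚ → x ≡ y) 
    refl-0   : ∀ x → d x x ≡ 0ℚ
    sym      : ∀ x y → d x y ≡ d y x
    triangle : ∀ x y z → d x z ≤ℚ d x y + d y z

-- Extended rationals: nothing = +∞  (d(c, ∅) = +∞).
ℚ∞ : Set
ℚ∞ = Maybe ℚ

_≤∞_ : ℚ∞ → ℚ∞ → Set
_       ≤∞ nothing = Unit
nothing ≤∞ just _  = Empty
just a  ≤∞ just b  = a ≤ℚ b

min∞ : ℚ∞ → ℚ∞ → ℚ∞
min∞ nothing y = y
min∞ (just a) nothing = just a
min∞ (just a) (just b) = just (a ⊓ b)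

max∞ : ℚ∞ → ℚ∞ → ℚ∞
max∞ nothing _ = nothing
max∞ (just a) nothing = nothing
max∞ (just a) (just b) = just (a ⊔ b)

distTo : {n : ℕ} → (Fin n → Fin n → ℚ) → Fin n → Subset n → ℚ∞
distTo {n} d c F = foldr min∞ nothing (map (λ f → just (d c f)) (filter (_∈? F) (allFin n)))

-- cost(F) = max_{c} d(c, F)   (distances are ≥ 0, so 0 is a neutral start)
cost : {n : ℕ} → (Fin n → Fin n → ℚ) → Subset n → ℚ∞
cost {n} d F = foldr max∞ (just 0ℚ) (map (λ c → distTo d c F) (allFin n))

Solution : {n : ℕ} → ℕ → Subset n → Set
Solution k F = ∣ F ∣ ℕ.≤ k

IsOPT : {n : ℕ} → (Fin n → Fin n → ℚ) → ℕ → ℚ → Set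
IsOPT {n} d k r =
  (Data.Product.Σ (Subset n) λ O → Solution k O Data.Product.× cost d O ≡ just r)
  Data.Product.× (∀ (G : Subset n) → Solution k G → just r ≤∞ cost d G)
  where import Data.Product

data ReverseGreedyRun {n : ℕ} (d : Fin n → Fin n → ℚ) : ℕ → Subset n → Subset n → Set where
  done : ∀ {F} → ReverseGreedyRun d zero F F
  step : ∀ {m F G} (f : Fin n) → f ∈ F →
         (∀ g → g ∈ F → cost d (F - f) ≤∞ cost d (F - g)) →
         ReverseGreedyRun d m (F - f) G →
         ReverseGreedyRun d (suc m) F G

ReverseGreedyOutput : {n : ℕ} → (Fin n → Fin n → ℚ) → ℕ → Subset n → Set
ReverseGreedyOutput {n} d k G = ReverseGreedyRun d (n ℕ.∸ k) ⊤ G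

ℕtoℚ : ℕ → ℚ
ℕtoℚ m = + m / 1

module Submission where

-- Fix an optimal solution O of cost r and send every point c to a nearest center
-- in O; the clusters of a set F are the centers of its points.  While |F| > k ≥ |O|, two points
-- of F share a cluster and deleting one of them keeps every cluster.  By the triangle inequality
-- through the common center, any F keeping all clusters of some H costs at most cost H + 2r, so a
-- greedy deletion costs at most that as well.  Hence the invariant "cost H ≤ 2 (k - #clusters F) r
-- for some H whose clusters F keeps" survives every step (H is the set at the last loss of a
-- cluster), and the output, which keeps at least one cluster, costs at most 2k r.
--
-- Lower bound (k = K + 2; for k = 1 a single point will do).  Hubs, pairwise at distance 2, lie
-- within 1 of a base point, and each gadget i < K is a center with clients within 1 of it, so
-- OPT = 1.  Reverse greedy may delete the base point and every client first and then the stage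
-- points in slot order: hub 0, and for each gadget its center (a free step: its clients fall back
-- on hubs at distance 2i+2), the hub nearest to the center and one more hub, each of these two
-- raising the cost by one because deleting any other point would strand some client or center
-- just as far.  The k hubs that remain cost 2K+2 = 2k-2.

open import Defs

module ReverseGreedy where

  open import Data.Empty using (⊥-elim)
  open import Data.Fin as Fin using (Fin; zero; suc; toℕ; fromℕ<)
  import Data.Fin.Properties as Fin
  open import Data.Fin.Subset using (Subset; _∈_; _∉_; _-_; _∪_; _⊆_; ⁅_⁆; ⊤; ⊥; ∣_∣; inside; outside; Nonempty)
  open import Data.Fin.Subset.Properties
    using (_∈?_; ∈⊤; nonempty?; Empty-unique; ∣⊥∣≡0; ∣⊤∣≡n; ∣⁅x⁆∣≡1; p─⊥≡p; ∣∁p∣≡n∸∣p∣; x∈∁p⇒x∉p;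
           ⊆-antisym; p─q⊆p; x∈p∧x≢y⇒x∈p-y; p⊆q⇒∣p∣≤∣q∣; p⊂q⇒∣p∣<∣q∣; x∈p∪q⁺; x∈⁅x⁆)
  import Data.Integer as ℤ
  import Data.Integer.Properties as ℤ
  open import Data.List using (List; []; _∷_; foldr; map; filter; allFin)
  open import Data.List.Relation.Unary.Any using (here; there)
  import Data.List.Membership.Propositional as List
  open import Data.List.Membership.Propositional.Properties using (∈-filter⁺; ∈-filter⁻; ∈-allFin)
  open import Data.Maybe as Maybe using (Maybe; just; nothing; maybe′)
  open import Data.Nat as ℕ using (ℕ; zero; suc; _+_; _*_; _∸_; _⊔_; _≤_; _<_; _≤?_; _<?_; z≤n; s≤s)
  import Data.Nat.Properties as ℕ
  import Data.Nat.Coprimality as Coprime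
  open import Data.Nat.DivMod
    using (_/_; _%_; m%n<n; m<n*o⇒m/o<n; [m+kn]%n≡m%n; m<n⇒m%n≡m; +-distrib-/; m<n⇒m/n≡0; m*n/n≡m; m*n%n≡0)
  open import Data.Product using (Σ; ∃-syntax; _×_; _,_; proj₁; proj₂)
  open import Data.Rational as ℚ using (ℚ; mkℚ; 0ℚ; 1ℚ)
  import Data.Rational.Properties as ℚ
  open import Data.Sum using (_⊎_; inj₁; inj₂)
  open import Data.Unit using (tt)
  open import Data.Vec as Vec using (_∷_; tabulate)
  open import Data.Vec.Properties using (lookup∘tabulate; lookup⇒[]=; []=⇒lookup)
  open import Level using (0ℓ)
  open import Relation.Nullary using (Dec; yes; no; does)
  open import Relation.Nullary.Decidable using (dec-true; _×-dec_)
  open import Relation.Unary using (Pred; Decidable)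
  open import Relation.Binary.PropositionalEquality
  open import Function.Metric.Definitions using (Symmetric; TriangleInequality)

  ≤∞-trans : ∀ {a b c} → a ≤∞ b → b ≤∞ c → a ≤∞ c
  ≤∞-trans {c = nothing}              _   _   = tt
  ≤∞-trans {just _} {just _} {just _} a≤b b≤c = ℚ.≤-trans a≤b b≤c

  module _ {A : Set} (g : A → ℚ) where

    minOf : List A → ℚ∞
    minOf ys = foldr min∞ nothing (map (λ y → just (g y)) ys)

    minOf-≤ : ∀ {y ys} → y List.∈ ys → minOf ys ≤∞ just (g y)
    minOf-≤ {ys = y ∷ ys} (here refl) with minOf ys
    ... | nothing = ℚ.≤-refl
    ... | just m  = ℚ.p⊓q≤p (g y) m
    minOf-≤ {ys = x ∷ ys} (there y∈ys) with minOf ys | minOf-≤ y∈ys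
    ... | just m | m≤ = ℚ.≤-trans (ℚ.p⊓q≤q (g x) m) m≤

    minOf-≥ : ∀ {q} ys → (∀ y → y List.∈ ys → q ℚ.≤ g y) → just q ≤∞ minOf ys
    minOf-≥ []       _ = tt
    minOf-≥ (y ∷ ys) h with minOf ys | minOf-≥ ys (λ z z∈ys → h z (there z∈ys))
    ... | nothing | _  = h y (here refl)
    ... | just m  | q≤ = ℚ.⊓-glb (h y (here refl)) q≤

    minOf-attained : ∀ {q} ys → minOf ys ≤∞ just q → ∃[ y ] y List.∈ ys × g y ℚ.≤ q
    minOf-attained (y ∷ ys) y∷ys≤q with minOf ys | minOf-attained ys | y∷ys≤q
    ... | nothing | _  | m≤q = y , here refl , m≤q
    ... | just m  | ih | m≤q with ℚ.≤-total (g y) m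
    ...   | inj₁ gy≤m = y , here refl , ℚ.≤-trans (ℚ.≤-reflexive (sym (ℚ.p≤q⇒p⊓q≡p gy≤m))) m≤q
    ...   | inj₂ m≤gy with ih (ℚ.≤-trans (ℚ.≤-reflexive (sym (ℚ.p≥q⇒p⊓q≡q m≤gy))) m≤q)
    ...     | z , z∈ys , gz≤q = z , there z∈ys , gz≤q

  module _ {A : Set} (h : A → ℚ∞) where

    maxOf : List A → ℚ∞
    maxOf ys = foldr max∞ (just 0ℚ) (map h ys)

    maxOf-≥ : ∀ {y ys} → y List.∈ ys → h y ≤∞ maxOf ys
    maxOf-≥ {y} {ys = y ∷ ys} (here refl) with h y | maxOf ys
    ... | nothing | _       = tt
    ... | just a  | nothing = tt
    ... | just a  | just m  = ℚ.p≤p⊔q a m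
    maxOf-≥ {y} {ys = x ∷ ys} (there y∈ys) with h x | maxOf ys | maxOf-≥ y∈ys
    ... | nothing | _       | _   = tt
    ... | just a  | nothing | _   = tt
    ... | just a  | just m  | y≤m = ≤∞-trans {h y} y≤m (ℚ.p≤q⊔p a m)

    maxOf-≤ : ∀ {q} ys → 0ℚ ℚ.≤ q → (∀ y → y List.∈ ys → h y ≤∞ just q) → maxOf ys ≤∞ just q
    maxOf-≤ []       0≤q _ = 0≤q
    maxOf-≤ (y ∷ ys) 0≤q hy≤ with h y | hy≤ y (here refl) | maxOf ys | maxOf-≤ ys 0≤q (λ z z∈ys → hy≤ z (there z∈ys))
    ... | just a | a≤q | just m | m≤q = ℚ.⊔-lub a≤q m≤q

    0≤maxOf : ∀ ys → just 0ℚ ≤∞ maxOf ys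
    0≤maxOf []       = ℚ.≤-refl
    0≤maxOf (y ∷ ys) with h y | maxOf ys | 0≤maxOf ys
    ... | nothing | _       | _   = tt
    ... | just a  | nothing | _   = tt
    ... | just a  | just m  | 0≤m = ℚ.≤-trans 0≤m (ℚ.p≤q⊔p a m)

  module _ {n : ℕ} (d : Fin n → Fin n → ℚ) where

    private
      elements : Subset n → List (Fin n)
      elements F = filter (_∈? F) (allFin n)

      ∈-elements⁺ : ∀ {F f} → f ∈ F → f List.∈ elements F
      ∈-elements⁺ {f = f} f∈F = ∈-filter⁺ (_∈? _) (∈-allFin f) f∈F

      ∈-elements⁻ : ∀ {F f} → f List.∈ elements F → f ∈ F
      ∈-elements⁻ f∈ = proj₂ (∈-filter⁻ (_∈? _) {xs = allFin n} f∈)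

      distTo≤ : ∀ {c F f} → f ∈ F → distTo d c F ≤∞ just (d c f)
      distTo≤ f∈F = minOf-≤ _ (∈-elements⁺ f∈F)

    Covers : Subset n → ℚ → Set
    Covers F q = ∀ c → ∃[ f ] f ∈ F × d c f ℚ.≤ q

    cost≤ : ∀ {F q} → 0ℚ ℚ.≤ q → Covers F q → cost d F ≤∞ just q
    cost≤ {F} 0≤q covers = maxOf-≤ _ (allFin n) 0≤q λ c _ →
      let f , f∈F , dcf≤q = covers c in ≤∞-trans {distTo d c F} (distTo≤ f∈F) dcf≤q

    cost≥ : ∀ {F q} c → (∀ f → f ∈ F → q ℚ.≤ d c f) → just q ≤∞ cost d F
    cost≥ {F} c far = ≤∞-trans {b = distTo d c F}
      (minOf-≥ _ (elements F) (λ f f∈ → far f (∈-elements⁻ f∈))) (maxOf-≥ _ (∈-allFin c))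

    cost≤⇒Covers : ∀ {F q} → cost d F ≤∞ just q → Covers F q
    cost≤⇒Covers {F} cost≤q c
      with f , f∈ , dcf≤q ← minOf-attained _ (elements F) (≤∞-trans {distTo d c F} (maxOf-≥ _ (∈-allFin c)) cost≤q)
      = f , ∈-elements⁻ f∈ , dcf≤q

    0≤cost : ∀ F → just 0ℚ ≤∞ cost d F
    0≤cost F = 0≤maxOf _ (allFin n)

    cost≡ : ∀ {F q} → 0ℚ ℚ.≤ q → Covers F q → ∀ c → (∀ f → f ∈ F → q ℚ.≤ d c f) → cost d F ≡ just q
    cost≡ {F} 0≤q covers c far with cost d F | cost≤ 0≤q covers | cost≥ c far
    ... | just m | m≤q | q≤m = cong just (ℚ.≤-antisym m≤q q≤m)

  ℕtoℚ≡mkℚ : ∀ m → ℕtoℚ m ≡ mkℚ (ℤ.+ m) 0 (Coprime.sym (Coprime.1-coprimeTo m))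
  ℕtoℚ≡mkℚ m = ℚ.normalize-coprime _

  ℕtoℚ-mono-≤ : ∀ {m n} → m ≤ n → ℕtoℚ m ℚ.≤ ℕtoℚ n
  ℕtoℚ-mono-≤ {m} {n} m≤n rewrite ℕtoℚ≡mkℚ m | ℕtoℚ≡mkℚ n =
    ℚ.*≤* (ℤ.*-monoʳ-≤-nonNeg (ℤ.+ 1) (ℤ.+≤+ m≤n))

  ℕtoℚ-+ : ∀ m n → ℕtoℚ (m + n) ≡ ℕtoℚ m ℚ.+ ℕtoℚ n
  ℕtoℚ-+ m n rewrite ℕtoℚ≡mkℚ m | ℕtoℚ≡mkℚ n =
    cong₂ (λ a b → (a ℤ.+ b) ℚ./ 1) (sym (ℤ.*-identityʳ (ℤ.+ m))) (sym (ℤ.*-identityʳ (ℤ.+ n)))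

  0≤ℕtoℚ : ∀ m → 0ℚ ℚ.≤ ℕtoℚ m
  0≤ℕtoℚ m = ℕtoℚ-mono-≤ {0} {m} z≤n

  module _ {n : ℕ} {P : Pred (Fin n) 0ℓ} (P? : Decidable P) where

    subsetOf : Subset n
    subsetOf = tabulate (λ x → does (P? x))

    ∈-subsetOf⁺ : ∀ {x} → P x → x ∈ subsetOf
    ∈-subsetOf⁺ {x} px = lookup⇒[]= x subsetOf (trans (lookup∘tabulate _ x) (dec-true (P? x) px))

    ∈-subsetOf⁻ : ∀ {x} → x ∈ subsetOf → P x
    ∈-subsetOf⁻ {x} x∈ with P? x | trans (sym (lookup∘tabulate (λ y → does (P? y)) x)) ([]=⇒lookup x∈)
    ... | yes px | _ = px

  x∉p-x : ∀ {n} (p : Subset n) x → x ∉ p - x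
  x∉p-x (_ ∷ p) zero    ()
  x∉p-x (_ ∷ p) (suc x) (Vec.there x∈) = x∉p-x p x x∈

  x∈p-y⇒x≢y : ∀ {n} {p : Subset n} {x y} → x ∈ p - y → x ≢ y
  x∈p-y⇒x≢y {p = p} {x} x∈ refl = x∉p-x p x x∈

  x∈p-y⇒x∈p : ∀ {n} {p : Subset n} {x y} → x ∈ p - y → x ∈ p
  x∈p-y⇒x∈p {p = p} {y = y} = p─q⊆p p _

  p-x-y⊆p-y : ∀ {n} {p : Subset n} {x y} → p - x - y ⊆ p - y
  p-x-y⊆p-y z∈ = x∈p∧x≢y⇒x∈p-y (x∈p-y⇒x∈p (x∈p-y⇒x∈p z∈)) (x∈p-y⇒x≢y z∈)

  ∣p∣≡1+∣p-x∣ : ∀ {n} {p : Subset n} {x} → x ∈ p → ∣ p ∣ ≡ suc ∣ p - x ∣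
  ∣p∣≡1+∣p-x∣ {p = inside  ∷ p} {zero}  _               = cong (λ q → suc ∣ q ∣) (sym (p─⊥≡p p))
  ∣p∣≡1+∣p-x∣ {p = inside  ∷ p} {suc x} (Vec.there x∈p) = cong suc (∣p∣≡1+∣p-x∣ x∈p)
  ∣p∣≡1+∣p-x∣ {p = outside ∷ p} {suc x} (Vec.there x∈p) = ∣p∣≡1+∣p-x∣ x∈p

  ∣p∪q∣≤∣p∣+∣q∣ : ∀ {n} (p q : Subset n) → ∣ p ∪ q ∣ ≤ ∣ p ∣ + ∣ q ∣
  ∣p∪q∣≤∣p∣+∣q∣ Vec.[]        Vec.[]        = z≤n
  ∣p∪q∣≤∣p∣+∣q∣ (inside  ∷ p) (inside  ∷ q) =
    s≤s (ℕ.≤-trans (∣p∪q∣≤∣p∣+∣q∣ p q) (ℕ.+-monoʳ-≤ ∣ p ∣ (ℕ.n≤1+n ∣ q ∣)))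
  ∣p∪q∣≤∣p∣+∣q∣ (inside  ∷ p) (outside ∷ q) = s≤s (∣p∪q∣≤∣p∣+∣q∣ p q)
  ∣p∪q∣≤∣p∣+∣q∣ (outside ∷ p) (inside  ∷ q) =
    ℕ.≤-trans (s≤s (∣p∪q∣≤∣p∣+∣q∣ p q)) (ℕ.≤-reflexive (sym (ℕ.+-suc ∣ p ∣ ∣ q ∣)))
  ∣p∪q∣≤∣p∣+∣q∣ (outside ∷ p) (outside ∷ q) = ∣p∪q∣≤∣p∣+∣q∣ p q

  ∣p∣>0⇒Nonempty : ∀ {n} {p : Subset n} → 0 < ∣ p ∣ → Nonempty p
  ∣p∣>0⇒Nonempty {n} {p} ∣p∣>0 with nonempty? p
  ... | yes ne = ne
  ... | no ¬ne = ⊥-elim (ℕ.<-irrefl (sym (∣⊥∣≡0 n)) (subst (λ q → 0 < ∣ q ∣) (Empty-unique ¬ne) ∣p∣>0))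

  ∣p∣<n⇒∃∉ : ∀ {n} {p : Subset n} → ∣ p ∣ < n → ∃[ x ] x ∉ p
  ∣p∣<n⇒∃∉ {n} {p} ∣p∣<n
    with x , x∈∁p ← ∣p∣>0⇒Nonempty (subst (0 <_) (sym (∣∁p∣≡n∸∣p∣ p)) (ℕ.m<n⇒0<n∸m ∣p∣<n)) = x , x∈∁p⇒x∉p x∈∁p

  -- The upper bound

  module UpperBound {n : ℕ} (d : Fin n → Fin n → ℚ) (d-metric : IsMetric d)
                    (k : ℕ) (O : Subset n) (∣O∣≤k : ∣ O ∣ ≤ k) (r : ℚ) (cost-O : cost d O ≡ just r) where

    open IsMetric d-metric using (refl-0; triangle) renaming (sym to d-sym)

    0≤r : 0ℚ ℚ.≤ r
    0≤r = subst (just 0ℚ ≤∞_) cost-O (0≤cost d O)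

    private
      covers-O : Covers d O r
      covers-O = cost≤⇒Covers d (subst (_≤∞ just r) (sym cost-O) ℚ.≤-refl)

    center : Fin n → Fin n
    center c = proj₁ (covers-O c)

    center∈O : ∀ c → center c ∈ O
    center∈O c = proj₁ (proj₂ (covers-O c))

    d-center : ∀ c → d c (center c) ℚ.≤ r
    d-center c = proj₂ (proj₂ (covers-O c))

    ClusterOf : Subset n → Fin n → Set
    ClusterOf F o = ∃[ f ] f ∈ F × center f ≡ o

    clusterOf? : ∀ F o → Dec (ClusterOf F o)
    clusterOf? F o = Fin.any? (λ f → (f ∈? F) ×-dec (center f Fin.≟ o))

    -- The opaque blocks keep unification from unfolding these definitions into huge normal forms.
    opaque
      clusters : Subset n → Subset n
      clusters F = subsetOf (clusterOf? F)

      ∈-clusters⁺ : ∀ {F f} → f ∈ F → center f ∈ clusters F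
      ∈-clusters⁺ {F} {f} f∈F = ∈-subsetOf⁺ (clusterOf? F) (f , f∈F , refl)

      ∈-clusters⁻ : ∀ {F o} → o ∈ clusters F → ClusterOf F o
      ∈-clusters⁻ {F} = ∈-subsetOf⁻ (clusterOf? F)

    clusters-mono : ∀ {F G} → F ⊆ G → clusters F ⊆ clusters G
    clusters-mono F⊆G o∈ with f , f∈F , refl ← ∈-clusters⁻ o∈ = ∈-clusters⁺ (F⊆G f∈F)

    ∣clusters∣≤k : ∀ F → ∣ clusters F ∣ ≤ k
    ∣clusters∣≤k F = ℕ.≤-trans (p⊆q⇒∣p∣≤∣q∣ clusters⊆O) ∣O∣≤k
      where
      clusters⊆O : clusters F ⊆ O
      clusters⊆O o∈ with f , _ , refl ← ∈-clusters⁻ o∈ = center∈O f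

    clusters-kept : ∀ {F f} → center f ∈ clusters (F - f) → clusters F ⊆ clusters (F - f)
    clusters-kept {F} {f} cf∈ o∈ with g , g∈F , refl ← ∈-clusters⁻ o∈ with g Fin.≟ f
    ... | yes refl = cf∈
    ... | no g≢f   = ∈-clusters⁺ (x∈p∧x≢y⇒x∈p-y g∈F g≢f)

    Redundant : Subset n → Set
    Redundant F = ∃[ g ] g ∈ F × center g ∈ clusters (F - g)

    redundant⊎∣F∣≤∣clusters∣ : ∀ m F → ∣ F ∣ ≡ m → Redundant F ⊎ ∣ F ∣ ≤ ∣ clusters F ∣
    redundant⊎∣F∣≤∣clusters∣ zero    F ∣F∣≡0 = inj₂ (subst (_≤ ∣ clusters F ∣) (sym ∣F∣≡0) z≤n)
    redundant⊎∣F∣≤∣clusters∣ (suc m) F ∣F∣≡1+m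
      with x , x∈F ← ∣p∣>0⇒Nonempty (subst (0 <_) (sym ∣F∣≡1+m) (s≤s z≤n))
      with redundant⊎∣F∣≤∣clusters∣ m (F - x) (ℕ.suc-injective (trans (sym (∣p∣≡1+∣p-x∣ x∈F)) ∣F∣≡1+m))
    ... | inj₁ (g , g∈F-x , cg∈) = inj₁ (g , x∈p-y⇒x∈p g∈F-x , clusters-mono p-x-y⊆p-y cg∈)
    ... | inj₂ ∣F-x∣≤ with center x ∈? clusters (F - x)
    ...   | yes cx∈ = inj₁ (x , x∈F , cx∈)
    ...   | no  cx∉ = inj₂ (begin
            ∣ F ∣                    ≡⟨ ∣p∣≡1+∣p-x∣ x∈F ⟩
            suc ∣ F - x ∣            ≤⟨ s≤s ∣F-x∣≤ ⟩
            suc ∣ clusters (F - x) ∣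
              ≤⟨ p⊂q⇒∣p∣<∣q∣ (clusters-mono (x∈p-y⇒x∈p {y = x}) , center x , ∈-clusters⁺ x∈F , cx∉) ⟩
            ∣ clusters F ∣           ∎)
      where open ℕ.≤-Reasoning

    redundant : ∀ {F} → k < ∣ F ∣ → Redundant F
    redundant {F} k<∣F∣ with redundant⊎∣F∣≤∣clusters∣ _ F refl
    ... | inj₁ red = red
    ... | inj₂ ∣F∣≤ = ⊥-elim (ℕ.<-irrefl refl (ℕ.<-≤-trans k<∣F∣ (ℕ.≤-trans ∣F∣≤ (∣clusters∣≤k F))))

    cost-via-clusters : ∀ {H F X} → clusters H ⊆ clusters F → cost d H ≤∞ just X →
                        cost d F ≤∞ just (X ℚ.+ (r ℚ.+ r))
    cost-via-clusters {H} {F} {X} H⊆F cost-H≤X = cost≤ d 0≤X+2r reach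
      where
      0≤X+2r : 0ℚ ℚ.≤ X ℚ.+ (r ℚ.+ r)
      0≤X+2r = ℚ.+-mono-≤ (≤∞-trans {just 0ℚ} (0≤cost d H) cost-H≤X) (ℚ.+-mono-≤ 0≤r 0≤r)
      reach : Covers d F (X ℚ.+ (r ℚ.+ r))
      reach c with h , h∈H , dch≤X ← cost≤⇒Covers d cost-H≤X c
              with f , f∈F , ch≡cf ← ∈-clusters⁻ (H⊆F (∈-clusters⁺ h∈H)) = f , f∈F , (begin
        d c f                                          ≤⟨ triangle c h f ⟩
        d c h ℚ.+ d h f                                ≤⟨ ℚ.+-monoʳ-≤ (d c h) (triangle h (center h) f) ⟩
        d c h ℚ.+ (d h (center h) ℚ.+ d (center h) f)  ≤⟨ ℚ.+-mono-≤ dch≤X (ℚ.+-mono-≤ (d-center h) d[ch,f]≤r) ⟩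
        X ℚ.+ (r ℚ.+ r)                                ∎)
        where
        open ℚ.≤-Reasoning
        d[ch,f]≤r : d (center h) f ℚ.≤ r
        d[ch,f]≤r = subst (ℚ._≤ r) (trans (d-sym f (center f)) (cong (λ o → d o f) ch≡cf)) (d-center f)

    opaque
      bound : ℕ → ℚ
      bound j = ℕtoℚ (2 * j) ℚ.* r

      bound≡ : ∀ j → bound j ≡ ℕtoℚ (2 * j) ℚ.* r
      bound≡ j = refl

      bound-mono : ∀ {i j} → i ≤ j → bound i ℚ.≤ bound j
      bound-mono i≤j = ℚ.*-monoʳ-≤-nonNeg r {{ℚ.nonNegative 0≤r}} (ℕtoℚ-mono-≤ (ℕ.*-monoʳ-≤ 2 i≤j))

      0≤bound : ∀ j → 0ℚ ℚ.≤ bound j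
      0≤bound j = subst (ℚ._≤ bound j) (ℚ.*-zeroˡ r) (bound-mono {0} {j} z≤n)

      bound-suc : ∀ j → bound j ℚ.+ (r ℚ.+ r) ≡ bound (suc j)
      bound-suc j = begin
        ℕtoℚ (2 * j) ℚ.* r ℚ.+ (r ℚ.+ r)        ≡⟨ cong (ℕtoℚ (2 * j) ℚ.* r ℚ.+_) 2r≡r+r ⟨
        ℕtoℚ (2 * j) ℚ.* r ℚ.+ ℕtoℚ 2 ℚ.* r    ≡⟨ ℚ.*-distribʳ-+ r (ℕtoℚ (2 * j)) (ℕtoℚ 2) ⟨
        (ℕtoℚ (2 * j) ℚ.+ ℕtoℚ 2) ℚ.* r        ≡⟨ cong (ℚ._* r) (ℕtoℚ-+ (2 * j) 2) ⟨
        ℕtoℚ (2 * j + 2) ℚ.* r                 ≡⟨ cong (λ m → ℕtoℚ m ℚ.* r) 2j+2≡2[1+j] ⟩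
        ℕtoℚ (2 * suc j) ℚ.* r                 ∎
        where
        open ≡-Reasoning
        2j+2≡2[1+j] : 2 * j + 2 ≡ 2 * suc j
        2j+2≡2[1+j] = trans (ℕ.+-comm (2 * j) 2) (sym (ℕ.*-suc 2 j))
        2r≡r+r : ℕtoℚ 2 ℚ.* r ≡ r ℚ.+ r
        2r≡r+r = trans (ℚ.*-distribʳ-+ r 1ℚ 1ℚ) (cong₂ ℚ._+_ (ℚ.*-identityˡ r) (ℚ.*-identityˡ r))

    Invariant : Subset n → Set
    Invariant F = ∃[ H ] clusters H ⊆ clusters F × cost d H ≤∞ just (bound (k ∸ ∣ clusters F ∣))

    invariant-⊤ : Invariant ⊤
    invariant-⊤ = ⊤ , (λ o∈ → o∈) ,
      cost≤ d (0≤bound j) λ c → c , ∈⊤ , subst (ℚ._≤ bound j) (sym (refl-0 c)) (0≤bound j)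
      where j = k ∸ ∣ clusters ⊤ ∣

    invariant-step : ∀ {F f} → k < ∣ F ∣ → f ∈ F → (∀ g → g ∈ F → cost d (F - f) ≤∞ cost d (F - g)) →
                     Invariant F → Invariant (F - f)
    invariant-step {F} {f} k<∣F∣ f∈F greedy (H , H⊆F , cost-H) with center f ∈? clusters (F - f)
    ... | yes cf∈ = H , (λ o∈ → clusters-kept cf∈ (H⊆F o∈)) ,
                    ≤∞-trans {cost d H} cost-H (bound-mono (ℕ.∸-monoʳ-≤ k (p⊆q⇒∣p∣≤∣q∣ (clusters-mono x∈p-y⇒x∈p))))
    ... | no  cf∉ with g , g∈F , cg∈ ← redundant k<∣F∣ =
      F - f , (λ o∈ → o∈) ,
      ≤∞-trans {cost d (F - f)} (greedy g g∈F) (≤∞-trans {cost d (F - g)} cost-F-g (bound-mono cluster-lost))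
      where
      cost-F-g : cost d (F - g) ≤∞ just (bound (suc (k ∸ ∣ clusters F ∣)))
      cost-F-g = subst (λ b → cost d (F - g) ≤∞ just b) (bound-suc (k ∸ ∣ clusters F ∣))
                   (cost-via-clusters (λ o∈ → clusters-kept cg∈ (H⊆F o∈)) cost-H)
      cluster-lost : suc (k ∸ ∣ clusters F ∣) ≤ k ∸ ∣ clusters (F - f) ∣
      cluster-lost = ℕ.∸-monoʳ-< (p⊂q⇒∣p∣<∣q∣ (clusters-mono x∈p-y⇒x∈p , center f , ∈-clusters⁺ f∈F , cf∉))
                                 (∣clusters∣≤k F)

    invariant-run : ∀ {m F G} → ReverseGreedyRun d m F G → k + m ≤ ∣ F ∣ → Invariant F → Invariant G × k ≤ ∣ G ∣
    invariant-run done                       k+0≤∣F∣ inv = inv , subst (_≤ _) (ℕ.+-identityʳ k) k+0≤∣F∣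
    invariant-run {suc m} {F} (step f f∈F greedy run) k+1+m≤∣F∣ inv =
      invariant-run run k+m≤∣F-f∣ (invariant-step (ℕ.<-≤-trans (ℕ.m<m+n k (s≤s z≤n)) k+1+m≤∣F∣) f∈F greedy inv)
      where
      k+m≤∣F-f∣ : k + m ≤ ∣ F - f ∣
      k+m≤∣F-f∣ = ℕ.≤-pred (subst₂ _≤_ (ℕ.+-suc k m) (∣p∣≡1+∣p-x∣ f∈F) k+1+m≤∣F∣)

    output-cost≤2k·r : 1 ≤ k → k ≤ n → ∀ {G} → ReverseGreedyOutput d k G → cost d G ≤∞ just (ℕtoℚ (2 * k) ℚ.* r)
    output-cost≤2k·r 1≤k k≤n {G} run
      with (H , H⊆G , cost-H) , k≤∣G∣ ← invariant-run run (ℕ.≤-reflexive (trans (ℕ.m+[n∸m]≡n k≤n) (sym (∣⊤∣≡n n))))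
                                                      invariant-⊤
      with g , g∈G ← ∣p∣>0⇒Nonempty (ℕ.<-≤-trans 1≤k k≤∣G∣) =
      ≤∞-trans {cost d G} cost-G
        (ℚ.≤-trans (bound-mono (ℕ.∸-monoʳ-< 0<∣clusters-G∣ (∣clusters∣≤k G))) (ℚ.≤-reflexive (bound≡ k)))
      where
      0<∣clusters-G∣ : 0 < ∣ clusters G ∣
      0<∣clusters-G∣ = subst (0 <_) (sym (∣p∣≡1+∣p-x∣ (∈-clusters⁺ g∈G))) (s≤s z≤n)
      cost-G : cost d G ≤∞ just (bound (suc (k ∸ ∣ clusters G ∣)))
      cost-G = subst (λ b → cost d G ≤∞ just b) (bound-suc (k ∸ ∣ clusters G ∣)) (cost-via-clusters H⊆G cost-H)

  reverseGreedy≤2k·OPT : ∀ k → 1 ≤ k → ∀ n → k ≤ n → (d : Fin n → Fin n → ℚ) → IsMetric d →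
    ∀ G → ReverseGreedyOutput d k G → ∀ r → IsOPT d k r → cost d G ≤∞ just (ℕtoℚ (2 * k) ℚ.* r)
  reverseGreedy≤2k·OPT k 1≤k n k≤n d d-metric G run r ((O , ∣O∣≤k , cost-O) , _) =
    UpperBound.output-cost≤2k·r d d-metric k O ∣O∣≤k r cost-O 1≤k k≤n run

  -- ℕ-valued pseudometrics

  record IsPseudometric {A : Set} (D : A → A → ℕ) : Set where
    field
      D-refl     : ∀ x → D x x ≡ 0
      D-sym      : Symmetric _≡_ D
      D-triangle : TriangleInequality _≤_ _+_ D

  open IsPseudometric

  pullback-isPseudometric : ∀ {A B : Set} {D : A → A → ℕ} (f : B → A) → IsPseudometric D →
                            IsPseudometric (λ x y → D (f x) (f y))
  pullback-isPseudometric f pD = record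
    { D-refl     = λ x → D-refl pD (f x)
    ; D-sym      = λ x y → D-sym pD (f x) (f y)
    ; D-triangle = λ x y z → D-triangle pD (f x) (f y) (f z)
    }

  ⊔-isPseudometric : ∀ {A : Set} {D E : A → A → ℕ} → IsPseudometric D → IsPseudometric E →
                     IsPseudometric (λ x y → D x y ⊔ E x y)
  ⊔-isPseudometric {D = D} {E} pD pE = record
    { D-refl     = λ x → cong₂ _⊔_ (D-refl pD x) (D-refl pE x)
    ; D-sym      = λ x y → cong₂ _⊔_ (D-sym pD x y) (D-sym pE x y)
    ; D-triangle = λ x y z → ℕ.⊔-lub
        (ℕ.≤-trans (D-triangle pD x y z) (ℕ.+-mono-≤ (ℕ.m≤m⊔n (D x y) (E x y)) (ℕ.m≤m⊔n (D y z) (E y z))))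
        (ℕ.≤-trans (D-triangle pE x y z) (ℕ.+-mono-≤ (ℕ.m≤n⊔m (D x y) (E x y)) (ℕ.m≤n⊔m (D y z) (E y z))))
    }

  sup : ℕ → (ℕ → ℕ) → ℕ
  sup zero    f = 0
  sup (suc U) f = f U ⊔ sup U f

  ≤-sup : ∀ U (f : ℕ → ℕ) {u} → u < U → f u ≤ sup U f
  ≤-sup (suc U) f u<1+U with ℕ.m≤n⇒m<n∨m≡n (ℕ.s≤s⁻¹ u<1+U)
  ... | inj₁ u<U  = ℕ.≤-trans (≤-sup U f u<U) (ℕ.m≤n⊔m (f U) (sup U f))
  ... | inj₂ refl = ℕ.m≤m⊔n (f U) (sup U f)

  sup-≤ : ∀ U (f : ℕ → ℕ) {t} → (∀ u → u < U → f u ≤ t) → sup U f ≤ t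
  sup-≤ zero    f _   = z≤n
  sup-≤ (suc U) f f≤t = ℕ.⊔-lub (f≤t U ℕ.≤-refl) (sup-≤ U f (λ u u<U → f≤t u (ℕ.m≤n⇒m≤1+n u<U)))

  supDist : ∀ {A : Set} → ℕ → (A → ℕ → ℕ) → A → A → ℕ
  supDist U a x y = sup U (λ u → ℕ.∣ a x u - a y u ∣)

  supDist-isPseudometric : ∀ {A : Set} U (a : A → ℕ → ℕ) → IsPseudometric (supDist U a)
  supDist-isPseudometric U a = record
    { D-refl     = λ x → ℕ.n≤0⇒n≡0 (sup-≤ U (coordDist x x) λ u _ → ℕ.≤-reflexive (ℕ.∣n-n∣≡0 (a x u)))
    ; D-sym      = λ x y → ℕ.≤-antisym (swap x y) (swap y x)
    ; D-triangle = λ x y z → sup-≤ U (coordDist x z) λ u u<U →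
        ℕ.≤-trans (ℕ.∣-∣-triangle (a x u) (a y u) (a z u)) (ℕ.+-mono-≤ (≤-sup U (coordDist x y) u<U) (≤-sup U (coordDist y z) u<U))
    }
    where
    coordDist : _ → _ → ℕ → ℕ
    coordDist x y u = ℕ.∣ a x u - a y u ∣
    swap : ∀ x y → supDist U a x y ≤ supDist U a y x
    swap x y = sup-≤ U (coordDist x y) λ u u<U →
      ℕ.≤-trans (ℕ.≤-reflexive (ℕ.∣-∣-comm (a x u) (a y u))) (≤-sup U (coordDist y x) u<U)

  ∣m-n∣≤t : ∀ {m n t} → m ≤ t → n ≤ t → ℕ.∣ m - n ∣ ≤ t
  ∣m-n∣≤t {m} {n} m≤t n≤t = ℕ.≤-trans (ℕ.∣m-n∣≤m⊔n m n) (ℕ.⊔-lub m≤t n≤t)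

  ∣n-1+n∣≡1 : ∀ n → ℕ.∣ n - suc n ∣ ≡ 1
  ∣n-1+n∣≡1 zero    = refl
  ∣n-1+n∣≡1 (suc n) = ∣n-1+n∣≡1 n

  ∣1+n-n∣≡1 : ∀ n → ℕ.∣ suc n - n ∣ ≡ 1
  ∣1+n-n∣≡1 n = trans (ℕ.∣-∣-comm (suc n) n) (∣n-1+n∣≡1 n)

  infix 0 if_≟_then_else_
  if_≟_then_else_ : ℕ → ℕ → ℕ → ℕ → ℕ
  if m ≟ n then a else b with m ℕ.≟ n
  ... | yes _ = a
  ... | no  _ = b

  if-≡ : ∀ {m n} a b → m ≡ n → (if m ≟ n then a else b) ≡ a
  if-≡ {m} {n} a b m≡n with m ℕ.≟ n
  ... | yes _   = refl
  ... | no  m≢n = ⊥-elim (m≢n m≡n)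

  if-≢ : ∀ {m n} a b → m ≢ n → (if m ≟ n then a else b) ≡ b
  if-≢ {m} {n} a b m≢n with m ℕ.≟ n
  ... | yes m≡n = ⊥-elim (m≢n m≡n)
  ... | no  _   = refl

  levelDist : ∀ {A : Set} → (A → ℕ) → A → A → ℕ
  levelDist ℓ x y = if ℓ x ≟ ℓ y then 0 else ℓ x ⊔ ℓ y

  levelDist-isPseudometric : ∀ {A : Set} (ℓ : A → ℕ) → IsPseudometric (levelDist ℓ)
  levelDist-isPseudometric ℓ = record { D-refl = diagonal ; D-sym = symmetric ; D-triangle = triangle }
    where
    diagonal : ∀ x → levelDist ℓ x x ≡ 0
    diagonal x = if-≡ {ℓ x} 0 _ refl
    symmetric : ∀ x y → levelDist ℓ x y ≡ levelDist ℓ y x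
    symmetric x y with ℓ x ℕ.≟ ℓ y | ℓ y ℕ.≟ ℓ x
    ... | yes _ | yes _ = refl
    ... | yes e | no ne = ⊥-elim (ne (sym e))
    ... | no ne | yes e = ⊥-elim (ne (sym e))
    ... | no _  | no _  = ℕ.⊔-comm (ℓ x) (ℓ y)
    triangle : ∀ x y z → levelDist ℓ x z ≤ levelDist ℓ x y + levelDist ℓ y z
    triangle x y z with ℓ x ℕ.≟ ℓ z
    ... | yes _ = z≤n
    ... | no x≢z with ℓ x ℕ.≟ ℓ y | ℓ y ℕ.≟ ℓ z
    ...   | yes x≡y | yes y≡z = ⊥-elim (x≢z (trans x≡y y≡z))
    ...   | yes x≡y | no _    = ℕ.≤-reflexive (cong (_⊔ ℓ z) x≡y)
    ...   | no _    | yes y≡z = ℕ.≤-trans (ℕ.≤-reflexive (cong (ℓ x ⊔_) (sym y≡z))) (ℕ.m≤m+n _ 0)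
    ...   | no _    | no _    = ℕ.⊔-lub (ℕ.≤-trans (ℕ.m≤m⊔n (ℓ x) (ℓ y)) (ℕ.m≤m+n _ _))
                                        (ℕ.≤-trans (ℕ.m≤n⊔m (ℓ y) (ℓ z)) (ℕ.m≤n+m _ _))

  discrete : ∀ {n} → Fin n → Fin n → ℕ
  discrete x y = if toℕ x ≟ toℕ y then 0 else 1

  discrete-isPseudometric : ∀ {n} → IsPseudometric (discrete {n})
  discrete-isPseudometric = record { D-refl = λ x → if-≡ {toℕ x} 0 1 refl ; D-sym = symmetric ; D-triangle = triangle }
    where
    symmetric : ∀ x y → discrete x y ≡ discrete y x
    symmetric x y with toℕ x ℕ.≟ toℕ y | toℕ y ℕ.≟ toℕ x
    ... | yes _ | yes _ = refl
    ... | yes e | no ne = ⊥-elim (ne (sym e))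
    ... | no ne | yes e = ⊥-elim (ne (sym e))
    ... | no _  | no _  = refl
    triangle : ∀ x y z → discrete x z ≤ discrete x y + discrete y z
    triangle x y z with toℕ x ℕ.≟ toℕ z
    ... | yes _ = z≤n
    ... | no x≢z with toℕ x ℕ.≟ toℕ y | toℕ y ℕ.≟ toℕ z
    ...   | yes x≡y | yes y≡z = ⊥-elim (x≢z (trans x≡y y≡z))
    ...   | yes _   | no _    = ℕ.≤-refl
    ...   | no _    | _       = s≤s z≤n

  discrete≤1 : ∀ {n} (x y : Fin n) → discrete x y ≤ 1
  discrete≤1 x y with toℕ x ℕ.≟ toℕ y
  ... | yes _ = z≤n
  ... | no  _ = ℕ.≤-refl

  1≤discrete : ∀ {n} {x y : Fin n} → x ≢ y → 1 ≤ discrete x y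
  1≤discrete {x = x} x≢y = ℕ.≤-reflexive (sym (if-≢ {toℕ x} 0 1 λ x≡y → x≢y (Fin.toℕ-injective x≡y)))

  ℕtoℚ-isMetric : ∀ {n} {D : Fin n → Fin n → ℕ} → IsPseudometric D → (∀ {x y} → x ≢ y → 1 ≤ D x y) →
                  IsMetric (λ x y → ℕtoℚ (D x y))
  ℕtoℚ-isMetric {D = D} pD separating = record
    { nonneg   = λ x y → 0≤ℕtoℚ (D x y)
    ; zero-iff = zero-iff
    ; refl-0   = λ x → cong ℕtoℚ (D-refl pD x)
    ; sym      = λ x y → cong ℕtoℚ (D-sym pD x y)
    ; triangle = λ x y z → subst (ℕtoℚ (D x z) ℚ.≤_) (ℕtoℚ-+ (D x y) (D y z)) (ℕtoℚ-mono-≤ (D-triangle pD x y z))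
    }
    where
    zero-iff : ∀ x y → ℕtoℚ (D x y) ≡ 0ℚ → x ≡ y
    zero-iff x y Dxy≡0 with x Fin.≟ y
    ... | yes x≡y = x≡y
    ... | no  x≢y = ⊥-elim (ℚ.<-irrefl refl (ℚ.<-≤-trans (ℚ.positive⁻¹ 1ℚ)
                      (subst (1ℚ ℚ.≤_) Dxy≡0 (ℕtoℚ-mono-≤ (separating x≢y)))))

  -- Reverse greedy runs in index order

  module InOrder {n : ℕ} (D : Fin n → Fin n → ℕ) where

    private
      d : Fin n → Fin n → ℚ
      d x y = ℕtoℚ (D x y)

    from : ℕ → Subset n
    from t = subsetOf (λ x → t ≤? toℕ x)

    ServedFrom : ℕ → ℕ → Set
    ServedFrom t θ = ∀ c → ∃[ y ] t ≤ toℕ y × D c y ≤ θ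

    SeparatedFrom : ℕ → ℕ → Set
    SeparatedFrom t θ = ∀ g → t ≤ toℕ g → ∃[ w ] (∀ y → t ≤ toℕ y → y ≢ g → θ ≤ D w y)

    private
      ∈-from⁺ : ∀ {t x} → t ≤ toℕ x → x ∈ from t
      ∈-from⁺ {t} = ∈-subsetOf⁺ (λ x → t ≤? toℕ x)

      ∈-from⁻ : ∀ {t x} → x ∈ from t → t ≤ toℕ x
      ∈-from⁻ {t} = ∈-subsetOf⁻ (λ x → t ≤? toℕ x)

      covers-from : ∀ {t θ} → ServedFrom t θ → Covers d (from t) (ℕtoℚ θ)
      covers-from served c with y , t≤y , Dcy≤θ ← served c = y , ∈-from⁺ t≤y , ℕtoℚ-mono-≤ Dcy≤θ

    from-0 : from 0 ≡ ⊤
    from-0 = ⊆-antisym (λ _ → ∈⊤) (λ _ → ∈-from⁺ z≤n)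

    from-suc : ∀ {t} (t<n : t < n) → from t - fromℕ< t<n ≡ from (suc t)
    from-suc {t} t<n = ⊆-antisym removed⊆ ⊆removed
      where
      toℕ-t : toℕ (fromℕ< t<n) ≡ t
      toℕ-t = Fin.toℕ-fromℕ< t<n
      removed⊆ : from t - fromℕ< t<n ⊆ from (suc t)
      removed⊆ {x} x∈ = ∈-from⁺ (ℕ.≤∧≢⇒< (∈-from⁻ (x∈p-y⇒x∈p x∈)) λ t≡x →
                          x∈p-y⇒x≢y x∈ (Fin.toℕ-injective (trans (sym t≡x) (sym toℕ-t))))
      ⊆removed : from (suc t) ⊆ from t - fromℕ< t<n
      ⊆removed {x} x∈ = x∈p∧x≢y⇒x∈p-y (∈-from⁺ (ℕ.<⇒≤ (∈-from⁻ x∈)))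
                          λ x≡t → ℕ.<-irrefl (trans (sym toℕ-t) (cong toℕ (sym x≡t))) (∈-from⁻ x∈)

    Removable : ℕ → Set
    Removable t = ∃[ θ ] ServedFrom (suc t) θ × SeparatedFrom t θ

    greedy-in-order : ∀ {t} (t<n : t < n) → Removable t →
                      ∀ g → g ∈ from t → cost d (from t - fromℕ< t<n) ≤∞ cost d (from t - g)
    greedy-in-order {t} t<n (θ , served , separated) g g∈ with w , far ← separated g (∈-from⁻ g∈) =
      ≤∞-trans {cost d (from t - fromℕ< t<n)}
        (subst (λ F → cost d F ≤∞ just (ℕtoℚ θ)) (sym (from-suc t<n)) (cost≤ d (0≤ℕtoℚ θ) (covers-from served)))
        (cost≥ d w λ y y∈ → ℕtoℚ-mono-≤ (far y (∈-from⁻ (x∈p-y⇒x∈p y∈)) (x∈p-y⇒x≢y y∈)))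

    run-in-order : ∀ {N} → N ≤ n → (∀ t → t < N → Removable t) →
                   ReverseGreedyRun d N ⊤ (from N)
    run-in-order {N} N≤n steps = subst (λ F → ReverseGreedyRun d N F (from N)) from-0 (run-from 0 N refl)
      where
      run-from : ∀ t m → t + m ≡ N → ReverseGreedyRun d m (from t) (from N)
      run-from t zero    t+0≡N = subst (λ u → ReverseGreedyRun d 0 (from t) (from u)) (trans (sym (ℕ.+-identityʳ t)) t+0≡N) done
      run-from t (suc m) t+1+m≡N =
        step (fromℕ< t<n) (∈-from⁺ (ℕ.≤-reflexive (sym (Fin.toℕ-fromℕ< t<n))))
             (greedy-in-order t<n (steps t t<N))
             (subst (λ F → ReverseGreedyRun d m F (from N)) (sym (from-suc t<n))
               (run-from (suc t) m (trans (sym (ℕ.+-suc t m)) t+1+m≡N)))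
        where
        t<N : t < N
        t<N = subst (t <_) t+1+m≡N (ℕ.m<m+n t (s≤s z≤n))
        t<n : t < n
        t<n = ℕ.<-≤-trans t<N N≤n

    cost-from : ∀ {t θ} → ServedFrom t θ → ∀ w → (∀ y → t ≤ toℕ y → θ ≤ D w y) → cost d (from t) ≡ just (ℕtoℚ θ)
    cost-from {θ = θ} served w far =
      cost≡ d (0≤ℕtoℚ θ) (covers-from served) w λ y y∈ → ℕtoℚ-mono-≤ (far y (∈-from⁻ y∈))

  -- The lower-bound instance

  data Kind : Set where
    base   : Kind
    hub    : ℕ → Kind
    center : ℕ → Kind
    client : ℕ → ℕ → Kind

  -- Slots and levels are written c + i * 3 and c + i * 2 so that they reduce by recursion on i.
  nearSlot : ℕ → ℕ
  nearSlot i = 2 + i * 3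

  level : Kind → ℕ
  level base         = 0
  level (hub _)      = 0
  level (center i)   = 2 + i * 2
  level (client i _) = 2 + i * 2

  -- In the distance D below, hubs are pairwise 2 apart and within 1 of base; client i v is within
  -- 1 of center i, at distance 2i+2 from hub v, 2i+3 from hub (nearSlot i) and 2i+4 from the other
  -- hubs; center i is 2i+2 from hub (nearSlot i) and 2i+3 from the other hubs; points of distinct
  -- gadgets i < j are at least 2j+2 apart.
  coord : Kind → ℕ → ℕ
  coord base         u = 1
  coord (hub w)      u = if u ≟ w then 0 else 2
  coord (center i)   u = if u ≟ nearSlot i then 2 + i * 2 else 3 + i * 2
  coord (client i v) u = if u ≟ v then 2 + i * 2 else (if u ≟ nearSlot i then 3 + i * 2 else 4 + i * 2)

  coord-hub≤2 : ∀ w u → coord (hub w) u ≤ 2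
  coord-hub≤2 w u with u ℕ.≟ w
  ... | yes _ = z≤n
  ... | no  _ = ℕ.≤-refl

  coord-center≤ : ∀ i u → coord (center i) u ≤ 3 + i * 2
  coord-center≤ i u with u ℕ.≟ nearSlot i
  ... | yes _ = ℕ.n≤1+n _
  ... | no  _ = ℕ.≤-refl

  coord-client≤ : ∀ i v u → coord (client i v) u ≤ 4 + i * 2
  coord-client≤ i v u with u ℕ.≟ v | u ℕ.≟ nearSlot i
  ... | yes _ | _     = ℕ.m≤n+m _ 2
  ... | no  _ | yes _ = ℕ.n≤1+n _
  ... | no  _ | no  _ = ℕ.≤-refl

  module Distance (U : ℕ) where

    opaque
      D : Kind → Kind → ℕ
      D κ κ′ = supDist U coord κ κ′ ⊔ levelDist level κ κ′

      D-isPseudometric : IsPseudometric D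
      D-isPseudometric = ⊔-isPseudometric (supDist-isPseudometric U coord) (levelDist-isPseudometric level)

      D-≤ : ∀ κ κ′ {t} → (∀ u → u < U → ℕ.∣ coord κ u - coord κ′ u ∣ ≤ t) → levelDist level κ κ′ ≤ t →
            D κ κ′ ≤ t
      D-≤ κ κ′ coords≤t level≤t = ℕ.⊔-lub (sup-≤ U (λ u → ℕ.∣ coord κ u - coord κ′ u ∣) coords≤t) level≤t

      coord-≤D : ∀ κ κ′ {u} → u < U → ℕ.∣ coord κ u - coord κ′ u ∣ ≤ D κ κ′
      coord-≤D κ κ′ u<U = ℕ.≤-trans (≤-sup U (λ u → ℕ.∣ coord κ u - coord κ′ u ∣) u<U) (ℕ.m≤m⊔n _ _)

      level-≤D : ∀ {κ κ′} → level κ ≢ level κ′ → level κ ⊔ level κ′ ≤ D κ κ′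
      level-≤D {κ} {κ′} ≢ = ℕ.≤-trans (ℕ.≤-reflexive (sym (if-≢ {level κ} 0 _ ≢))) (ℕ.m≤n⊔m _ _)

    D-self≤ : ∀ κ {t} → D κ κ ≤ t
    D-self≤ κ = ℕ.≤-trans (ℕ.≤-reflexive (D-refl D-isPseudometric κ)) z≤n

    D-base-hub≤ : ∀ w → D base (hub w) ≤ 1
    D-base-hub≤ w = D-≤ base (hub w) coords z≤n
      where
      coords : ∀ u → u < U → ℕ.∣ 1 - coord (hub w) u ∣ ≤ 1
      coords u _ with u ℕ.≟ w
      ... | yes _ = ℕ.≤-refl
      ... | no  _ = ℕ.≤-refl

    D-client-center≤ : ∀ i v → D (client i v) (center i) ≤ 1
    D-client-center≤ i v = D-≤ (client i v) (center i) coords (ℕ.≤-trans (ℕ.≤-reflexive (if-≡ {2 + i * 2} 0 _ refl)) z≤n)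
      where
      coords : ∀ u → u < U → ℕ.∣ coord (client i v) u - coord (center i) u ∣ ≤ 1
      coords u _ with u ℕ.≟ v | u ℕ.≟ nearSlot i
      ... | yes _ | yes _ = ℕ.≤-trans (ℕ.≤-reflexive (ℕ.∣n-n∣≡0 (2 + i * 2))) z≤n
      ... | yes _ | no  _ = ℕ.≤-reflexive (∣n-1+n∣≡1 (2 + i * 2))
      ... | no  _ | yes _ = ℕ.≤-reflexive (∣1+n-n∣≡1 (2 + i * 2))
      ... | no  _ | no  _ = ℕ.≤-reflexive (∣1+n-n∣≡1 (3 + i * 2))

    D-hub-hub≤ : ∀ u w → D (hub u) (hub w) ≤ 2
    D-hub-hub≤ u w = D-≤ (hub u) (hub w) (λ x _ → ∣m-n∣≤t (coord-hub≤2 u x) (coord-hub≤2 w x)) z≤n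

    D-client-hub≤ : ∀ i v w → D (client i v) (hub w) ≤ 4 + i * 2
    D-client-hub≤ i v w = D-≤ (client i v) (hub w)
      (λ u _ → ∣m-n∣≤t (coord-client≤ i v u) (ℕ.≤-trans (coord-hub≤2 w u) (ℕ.m≤m+n 2 _))) (ℕ.m≤n+m _ 2)

    D-client-ownHub≤ : ∀ i v → D (client i v) (hub v) ≤ 2 + i * 2
    D-client-ownHub≤ i v = D-≤ (client i v) (hub v) coords ℕ.≤-refl
      where
      coords : ∀ u → u < U → ℕ.∣ coord (client i v) u - coord (hub v) u ∣ ≤ 2 + i * 2
      coords u _ with u ℕ.≟ v | u ℕ.≟ nearSlot i
      ... | yes _ | _     = ℕ.≤-refl
      ... | no  _ | yes _ = ℕ.n≤1+n _
      ... | no  _ | no  _ = ℕ.≤-refl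

    D-center-hub≤ : ∀ i w → D (center i) (hub w) ≤ 3 + i * 2
    D-center-hub≤ i w = D-≤ (center i) (hub w)
      (λ u _ → ∣m-n∣≤t (coord-center≤ i u) (ℕ.≤-trans (coord-hub≤2 w u) (ℕ.m≤m+n 2 _))) (ℕ.n≤1+n _)

    D-center-nearHub≤ : ∀ i → D (center i) (hub (nearSlot i)) ≤ 2 + i * 2
    D-center-nearHub≤ i = D-≤ (center i) (hub (nearSlot i)) coords ℕ.≤-refl
      where
      coords : ∀ u → u < U → ℕ.∣ coord (center i) u - coord (hub (nearSlot i)) u ∣ ≤ 2 + i * 2
      coords u _ with u ℕ.≟ nearSlot i
      ... | yes _ = ℕ.≤-refl
      ... | no  _ = ℕ.n≤1+n _

    D-hub-hub≥ : ∀ {u w} → u < U → u ≢ w → 2 ≤ D (hub u) (hub w)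
    D-hub-hub≥ {u} {w} u<U u≢w = subst (_≤ D (hub u) (hub w))
      (cong₂ ℕ.∣_-_∣ (if-≡ {u} 0 2 refl) (if-≢ {u} 0 2 u≢w)) (coord-≤D (hub u) (hub w) u<U)

    D-center-hub≥ : ∀ {i w} → w < U → w ≢ nearSlot i → 3 + i * 2 ≤ D (center i) (hub w)
    D-center-hub≥ {i} {w} w<U w≢near = subst (_≤ D (center i) (hub w))
      (cong₂ ℕ.∣_-_∣ (if-≢ {w} (2 + i * 2) _ w≢near) (if-≡ {w} 0 2 refl)) (coord-≤D (center i) (hub w) w<U)

    D-client-hub≥ : ∀ {i v w} → w < U → w ≢ v → w ≢ nearSlot i → 4 + i * 2 ≤ D (client i v) (hub w)
    D-client-hub≥ {i} {v} {w} w<U w≢v w≢near = subst (_≤ D (client i v) (hub w))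
      (cong₂ ℕ.∣_-_∣ (trans (if-≢ {w} (2 + i * 2) _ w≢v) (if-≢ {w} (3 + i * 2) _ w≢near)) (if-≡ {w} 0 2 refl))
      (coord-≤D (client i v) (hub w) w<U)

    D-client-nearHub≥ : ∀ {i v} → nearSlot i < U → nearSlot i ≢ v → 3 + i * 2 ≤ D (client i v) (hub (nearSlot i))
    D-client-nearHub≥ {i} {v} near<U near≢v = subst (_≤ D (client i v) (hub (nearSlot i)))
      (cong₂ ℕ.∣_-_∣ (trans (if-≢ {nearSlot i} (2 + i * 2) _ near≢v) (if-≡ {nearSlot i} (3 + i * 2) _ refl))
                     (if-≡ {nearSlot i} 0 2 refl))
      (coord-≤D (client i v) (hub (nearSlot i)) near<U)

  -- Stage slot 1 + i * 3 holds center i for i < K; every other stage slot u holds hub u.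
  centerAt : ℕ → ℕ → Maybe ℕ
  centerAt zero    _                         = nothing
  centerAt (suc K) 1                         = just 0
  centerAt (suc K) (suc (suc (suc (suc u)))) = Maybe.map suc (centerAt K (suc u))
  centerAt (suc K) _                         = nothing

  centerAt-slot : ∀ {K i} → i < K → centerAt K (1 + i * 3) ≡ just i
  centerAt-slot {suc K} {zero}  _         = refl
  centerAt-slot {suc K} {suc i} (s≤s i<K) = cong (Maybe.map suc) (centerAt-slot i<K)

  centerAt-just : ∀ K u {i} → centerAt K u ≡ just i → u ≡ 1 + i * 3 × i < K
  centerAt-just (suc K) 1                         refl = refl , s≤s z≤n
  centerAt-just (suc K) (suc (suc (suc (suc u))))  eq  with centerAt K (suc u) in e
  ... | just j with refl ← eq with u≡ , j<K ← centerAt-just K (suc u) e = cong (3 +_) u≡ , s≤s j<K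

  centerAt-0 : ∀ K → centerAt K 0 ≡ nothing
  centerAt-0 zero    = refl
  centerAt-0 (suc K) = refl

  centerAt-near : ∀ K i → centerAt K (nearSlot i) ≡ nothing
  centerAt-near zero    _       = refl
  centerAt-near (suc K) zero    = refl
  centerAt-near (suc K) (suc i) = cong (Maybe.map suc) (centerAt-near K i)

  centerAt-last : ∀ K i → centerAt K (3 + i * 3) ≡ nothing
  centerAt-last zero    _       = refl
  centerAt-last (suc K) zero    = refl
  centerAt-last (suc K) (suc i) = cong (Maybe.map suc) (centerAt-last K i)

  -- The cost of the run once the first p stage points are deleted.
  threshold : ℕ → ℕ
  threshold 0                          = 1
  threshold 1                          = 2
  threshold 2                          = 2
  threshold 3                          = 3
  threshold (suc (suc (suc p@(suc _)))) = 2 + threshold p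

  threshold-suc : ∀ p → threshold p ≤ threshold (suc p)
  threshold-suc 0                          = s≤s z≤n
  threshold-suc 1                          = ℕ.≤-refl
  threshold-suc 2                          = s≤s (s≤s z≤n)
  threshold-suc 3                          = s≤s (s≤s (s≤s z≤n))
  threshold-suc (suc (suc (suc p@(suc _)))) = s≤s (s≤s (threshold-suc p))

  threshold-mono : ∀ {p q} → p ≤ q → threshold p ≤ threshold q
  threshold-mono {q = zero}  z≤n = ℕ.≤-refl
  threshold-mono {p} {suc q} p≤1+q with ℕ.m≤n⇒m<n∨m≡n p≤1+q
  ... | inj₁ p<1+q = ℕ.≤-trans (threshold-mono (ℕ.s≤s⁻¹ p<1+q)) (threshold-suc q)
  ... | inj₂ refl  = ℕ.≤-refl

  threshold-center : ∀ i → threshold (1 + i * 3) ≡ 2 + i * 2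
  threshold-center zero    = refl
  threshold-center (suc i) = cong (2 +_) (threshold-center i)

  threshold-near : ∀ i → threshold (2 + i * 3) ≡ 2 + i * 2
  threshold-near zero    = refl
  threshold-near (suc i) = cong (2 +_) (threshold-near i)

  threshold-last : ∀ i → threshold (3 + i * 3) ≡ 3 + i * 2
  threshold-last zero    = refl
  threshold-last (suc i) = cong (2 +_) (threshold-last i)

  ≤threshold : ∀ {p q t} → threshold q ≡ t → q ≤ p → t ≤ threshold p
  ≤threshold refl q≤p = threshold-mono q≤p

  1≤threshold : ∀ p → 1 ≤ threshold p
  1≤threshold p = threshold-mono {0} {p} z≤n

  slot-< : ∀ {a b} i j → b < a → a + i * 3 ≤ b + j * 3 → i < j
  slot-< {a} {b} i j b<a ≤ = ℕ.*-cancelʳ-< 3 i j (ℕ.+-cancelˡ-< b _ _ (ℕ.<-≤-trans (ℕ.+-monoˡ-< (i * 3) b<a) ≤))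

  gadget-gap : ∀ {i j} → i < j → 4 + i * 2 ≤ 2 + j * 2
  gadget-gap i<j = s≤s (s≤s (ℕ.*-monoˡ-≤ 2 i<j))

  module Construction (K : ℕ) where

    U : ℕ
    U = 3 + K * 4

    open Distance U public

    stageStart : ℕ
    stageStart = suc (K * U)

    n : ℕ
    n = stageStart + U

    -- The client block is a K × U grid; the slots of unwanted clients hold copies of the base point.
    blockKind : ℕ → ℕ → Kind
    blockKind i v with 3 + i * 3 ≤? v | centerAt K v
    ... | yes _ | nothing = client i v
    ... | _     | _       = base

    stageKind : ℕ → Kind
    stageKind u = maybe′ center (hub u) (centerAt K u)

    kindAt : ℕ → Kind
    kindAt zero    = base
    kindAt (suc m) with m <? K * U
    ... | yes _ = blockKind (m / U) (m % U)
    ... | no  _ = stageKind (m ∸ K * U)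

    kind : Fin n → Kind
    kind x = kindAt (toℕ x)

    opaque
      dist : Fin n → Fin n → ℕ
      dist x y = D (kind x) (kind y) ⊔ discrete x y

      dist-isPseudometric : IsPseudometric dist
      dist-isPseudometric = ⊔-isPseudometric (pullback-isPseudometric kind D-isPseudometric) discrete-isPseudometric

      1≤dist : ∀ {x y} → x ≢ y → 1 ≤ dist x y
      1≤dist {x} {y} x≢y = ℕ.≤-trans (1≤discrete x≢y) (ℕ.m≤n⊔m (D (kind x) (kind y)) _)

      dist-≤ : ∀ {x y κ κ′ t} → kind x ≡ κ → kind y ≡ κ′ → D κ κ′ ≤ t → 1 ≤ t → dist x y ≤ t
      dist-≤ refl refl D≤t 1≤t = ℕ.⊔-lub D≤t (ℕ.≤-trans (discrete≤1 _ _) 1≤t)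

      ≤-dist : ∀ {x y κ κ′ t} → kind x ≡ κ → kind y ≡ κ′ → t ≤ D κ κ′ → t ≤ dist x y
      ≤-dist refl refl t≤D = ℕ.≤-trans t≤D (ℕ.m≤m⊔n _ _)

      dist-refl : ∀ x → dist x x ≡ 0
      dist-refl = D-refl dist-isPseudometric

    blockKind-cases : ∀ i v → blockKind i v ≡ base ⊎ (blockKind i v ≡ client i v × 3 + i * 3 ≤ v × centerAt K v ≡ nothing)
    blockKind-cases i v with 3 + i * 3 ≤? v | centerAt K v
    ... | yes ≤v | nothing = inj₂ (refl , ≤v , refl)
    ... | yes _  | just _  = inj₁ refl
    ... | no  _  | _       = inj₁ refl

    blockKind-client : ∀ {i v} → 3 + i * 3 ≤ v → centerAt K v ≡ nothing → blockKind i v ≡ client i v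
    blockKind-client {i} {v} ≤v free with 3 + i * 3 ≤? v | centerAt K v
    ... | yes _  | nothing = refl
    ... | no  ≰v | _       = ⊥-elim (≰v ≤v)

    stageKind-cases : ∀ u → (stageKind u ≡ hub u × centerAt K u ≡ nothing) ⊎
                            (∃[ i ] stageKind u ≡ center i × u ≡ 1 + i * 3 × i < K)
    stageKind-cases u with centerAt K u in e
    ... | nothing = inj₁ (refl , refl)
    ... | just i  = inj₂ (i , refl , centerAt-just K u e)

    stageKind-hub : ∀ {u} → centerAt K u ≡ nothing → stageKind u ≡ hub u
    stageKind-hub free = cong (maybe′ center (hub _)) free

    kindAt-block : ∀ {m} → m < K * U → kindAt (suc m) ≡ blockKind (m / U) (m % U)
    kindAt-block {m} m<KU with m <? K * U
    ... | yes _   = refl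
    ... | no  m≮ = ⊥-elim (m≮ m<KU)

    kindAt-stage : ∀ u → kindAt (stageStart + u) ≡ stageKind u
    kindAt-stage u with K * U + u <? K * U
    ... | yes <KU = ⊥-elim (ℕ.m+n≮m (K * U) u <KU)
    ... | no  _   = cong stageKind (ℕ.m+n∸m≡n (K * U) u)

    data View (m : ℕ) : Set where
      base   : kindAt m ≡ base → m < stageStart → View m
      client : ∀ {i v} → kindAt m ≡ client i v → m < stageStart →
               i < K → v < U → 3 + i * 3 ≤ v → centerAt K v ≡ nothing → View m
      hub    : ∀ {u} → kindAt m ≡ hub u → m ≡ stageStart + u → u < U → centerAt K u ≡ nothing → View m
      center : ∀ {i} → kindAt m ≡ center i → m ≡ stageStart + (1 + i * 3) → i < K → View m

    view : ∀ m → m < n → View m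
    view zero    _   = base refl (s≤s z≤n)
    view (suc m) m<n with m <? K * U
    ... | yes m<KU with blockKind-cases (m / U) (m % U)
    ...   | inj₁ ≡base = base (trans (kindAt-block m<KU) ≡base) (s≤s m<KU)
    ...   | inj₂ (≡client , ≤v , free) =
            client (trans (kindAt-block m<KU) ≡client) (s≤s m<KU) (m<n*o⇒m/o<n m<KU) (m%n<n m U) ≤v free
    view (suc m) m<n | no m≮KU = stage (m ∸ K * U) (cong suc (sym (ℕ.m+[n∸m]≡n (ℕ.≮⇒≥ m≮KU))))
      where
      stage : ∀ u → suc m ≡ stageStart + u → View (suc m)
      stage u refl with stageKind-cases u
      ... | inj₁ (≡hub , free) = hub (trans (kindAt-stage u) ≡hub) refl (ℕ.+-cancelˡ-< stageStart _ _ m<n) free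
      ... | inj₂ (i , ≡center , refl , i<K) = center (trans (kindAt-stage _) ≡center) refl i<K

    stagePt : ∀ u → .(u < U) → Fin n
    stagePt u u<U = fromℕ< (ℕ.+-monoʳ-< stageStart u<U)

    toℕ-stagePt : ∀ {u} .(u<U : u < U) → toℕ (stagePt u u<U) ≡ stageStart + u
    toℕ-stagePt u<U = Fin.toℕ-fromℕ< (ℕ.+-monoʳ-< stageStart u<U)

    kind-stagePt : ∀ {u} .(u<U : u < U) → kind (stagePt u u<U) ≡ stageKind u
    kind-stagePt {u} u<U = trans (cong kindAt (toℕ-stagePt u<U)) (kindAt-stage u)

    kind-hubPt : ∀ {u} .(u<U : u < U) → centerAt K u ≡ nothing → kind (stagePt u u<U) ≡ hub u
    kind-hubPt u<U free = trans (kind-stagePt u<U) (stageKind-hub free)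

    slot<U : ∀ {c i} → c ≤ 2 → i ≤ K → c + i * 3 < U
    slot<U c≤2 i≤K =
      ℕ.≤-trans (s≤s (ℕ.+-mono-≤ c≤2 (ℕ.*-monoˡ-≤ 3 i≤K))) (s≤s (s≤s (s≤s (ℕ.*-monoʳ-≤ K (ℕ.n≤1+n 3)))))

    centerSlot<U : ∀ {i} → i < K → 1 + i * 3 < U
    centerSlot<U i<K = slot<U (s≤s z≤n) (ℕ.<⇒≤ i<K)

    centerPt : ∀ i → .(i < K) → Fin n
    centerPt i i<K = stagePt (1 + i * 3) (centerSlot<U i<K)

    kind-centerPt : ∀ {i} (i<K : i < K) → kind (centerPt i i<K) ≡ center i
    kind-centerPt {i} i<K = trans (kind-stagePt (centerSlot<U i<K)) (cong (maybe′ center (hub _)) (centerAt-slot i<K))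

    clientIndex<KU : ∀ {i v} → i < K → v < U → v + i * U < K * U
    clientIndex<KU {i} i<K v<U = ℕ.<-≤-trans (ℕ.+-monoˡ-< (i * U) v<U) (ℕ.*-monoˡ-≤ U i<K)

    clientIndex<n : ∀ {i v} → i < K → v < U → suc (v + i * U) < n
    clientIndex<n i<K v<U = ℕ.<-≤-trans (s≤s (clientIndex<KU i<K v<U)) (ℕ.m≤m+n stageStart U)

    clientPt : ∀ i v → .(i < K) → .(v < U) → Fin n
    clientPt i v i<K v<U = fromℕ< (clientIndex<n i<K v<U)

    kind-clientPt : ∀ {i v} (i<K : i < K) (v<U : v < U) → 3 + i * 3 ≤ v → centerAt K v ≡ nothing →
                    kind (clientPt i v i<K v<U) ≡ client i v
    kind-clientPt {i} {v} i<K v<U ≤v free = begin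
      kindAt (toℕ (clientPt i v i<K v<U))      ≡⟨ cong kindAt (Fin.toℕ-fromℕ< (clientIndex<n i<K v<U)) ⟩
      kindAt (suc (v + i * U))                 ≡⟨ kindAt-block (clientIndex<KU i<K v<U) ⟩
      blockKind ((v + i * U) / U) ((v + i * U) % U) ≡⟨ cong₂ blockKind quotient remainder ⟩
      blockKind i v                            ≡⟨ blockKind-client ≤v free ⟩
      client i v                               ∎
      where
      open ≡-Reasoning
      v%U≡v : v % U ≡ v
      v%U≡v = m<n⇒m%n≡m v<U
      remainder : (v + i * U) % U ≡ v
      remainder = trans ([m+kn]%n≡m%n v i U) v%U≡v
      no-carry : v % U + (i * U) % U < U
      no-carry = subst (_< U) (sym (cong₂ _+_ v%U≡v (m*n%n≡0 i U))) (subst (_< U) (sym (ℕ.+-identityʳ v)) v<U)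
      quotient : (v + i * U) / U ≡ i
      quotient = trans (+-distrib-/ v (i * U) no-carry) (cong₂ _+_ (m<n⇒m/n≡0 v<U) (m*n/n≡m i U))

    data Survivor (p : ℕ) (y : Fin n) : Set where
      hub    : ∀ {u} → kind y ≡ hub u → toℕ y ≡ stageStart + u → p ≤ u → u < U → centerAt K u ≡ nothing → Survivor p y
      center : ∀ {i} → kind y ≡ center i → toℕ y ≡ stageStart + (1 + i * 3) → p ≤ 1 + i * 3 → i < K → Survivor p y

    survivor : ∀ {p y} → stageStart + p ≤ toℕ y → Survivor p y
    survivor {p} {y} ≤y with view (toℕ y) (Fin.toℕ<n y)
    ... | base _ y<S             = ⊥-elim (ℕ.<-irrefl refl (ℕ.<-≤-trans y<S (ℕ.≤-trans (ℕ.m≤m+n stageStart p) ≤y)))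
    ... | client _ y<S _ _ _ _   = ⊥-elim (ℕ.<-irrefl refl (ℕ.<-≤-trans y<S (ℕ.≤-trans (ℕ.m≤m+n stageStart p) ≤y)))
    ... | hub ≡hub y≡ u<U free   = hub ≡hub y≡ (ℕ.+-cancelˡ-≤ stageStart _ _ (subst (stageStart + p ≤_) y≡ ≤y)) u<U free
    ... | center ≡center y≡ i<K  = center ≡center y≡ (ℕ.+-cancelˡ-≤ stageStart _ _ (subst (stageStart + p ≤_) y≡ ≤y)) i<K

    slots-differ : ∀ {x y : Fin n} {a b} → toℕ x ≡ stageStart + a → toℕ y ≡ stageStart + b → x ≢ y → a ≢ b
    slots-differ x≡ y≡ x≢y refl = x≢y (Fin.toℕ-injective (trans x≡ (sym y≡)))

    slot-survives : ∀ {y : Fin n} {a p} → toℕ y ≡ stageStart + a → p ≤ a → stageStart + p ≤ toℕ y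
    slot-survives y≡ p≤a = subst (_ ≤_) (sym y≡) (ℕ.+-monoʳ-≤ stageStart p≤a)

    lastHub : Fin n
    lastHub = stagePt (nearSlot K) (slot<U ℕ.≤-refl ℕ.≤-refl)

    kind-lastHub : kind lastHub ≡ hub (nearSlot K)
    kind-lastHub = kind-hubPt (slot<U ℕ.≤-refl ℕ.≤-refl) (centerAt-near K K)

    lastHub-survives : ∀ {p} → p ≤ 1 + K * 3 → stageStart + p ≤ toℕ lastHub
    lastHub-survives p≤ = slot-survives (toℕ-stagePt (slot<U ℕ.≤-refl ℕ.≤-refl)) (ℕ.m≤n⇒m≤1+n p≤)

    open InOrder dist public using (ServedFrom; SeparatedFrom; Removable; from; run-in-order; cost-from)

    dist≤threshold : ∀ {x y κ κ′} p → kind x ≡ κ → kind y ≡ κ′ → D κ κ′ ≤ threshold p → dist x y ≤ threshold p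
    dist≤threshold p ≡κ ≡κ′ D≤ = dist-≤ ≡κ ≡κ′ D≤ (1≤threshold p)

    dist-self≤ : ∀ x {t} → dist x x ≤ t
    dist-self≤ x = ℕ.≤-trans (ℕ.≤-reflexive (dist-refl x)) z≤n

    served : ∀ p → p ≤ 1 + K * 3 → ServedFrom (stageStart + p) (threshold p)
    served p p≤ c with view (toℕ c) (Fin.toℕ<n c)
    ... | base ≡base _ = lastHub , lastHub-survives p≤ ,
          dist≤threshold p ≡base kind-lastHub (ℕ.≤-trans (D-base-hub≤ _) (1≤threshold p))
    ... | hub {u} ≡hub c≡ _ _ with p ≤? u
    ...   | yes p≤u = c , slot-survives c≡ p≤u , dist-self≤ c
    ...   | no  p≰u = lastHub , lastHub-survives p≤ ,
            dist≤threshold p ≡hub kind-lastHub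
              (ℕ.≤-trans (D-hub-hub≤ u _) (≤threshold {q = 1} refl (ℕ.≤-trans (s≤s z≤n) (ℕ.≰⇒> p≰u))))
    served p p≤ c | center {i} ≡center c≡ i<K with p ≤? 1 + i * 3
    ...   | yes p≤ = c , slot-survives c≡ p≤ , dist-self≤ c
    ...   | no  p≰ with p ≤? nearSlot i
    ...     | yes p≤near = stagePt (nearSlot i) near<U , slot-survives (toℕ-stagePt near<U) p≤near ,
              dist≤threshold p ≡center (kind-hubPt near<U (centerAt-near K i))
                (ℕ.≤-trans (D-center-nearHub≤ i) (≤threshold (threshold-near i) (ℕ.≰⇒> p≰)))
      where near<U = slot<U ℕ.≤-refl (ℕ.<⇒≤ i<K)
    ...     | no  p≰near = lastHub , lastHub-survives p≤ ,
              dist≤threshold p ≡center kind-lastHub (ℕ.≤-trans (D-center-hub≤ i _) (≤threshold (threshold-last i) (ℕ.≰⇒> p≰near)))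
    served p p≤ c | client {i} {v} ≡client _ i<K v<U ≤v free with p ≤? 1 + i * 3
    ...   | yes p≤ = centerPt i i<K , slot-survives (toℕ-stagePt (centerSlot<U i<K)) p≤ ,
            dist≤threshold p ≡client (kind-centerPt i<K) (ℕ.≤-trans (D-client-center≤ i v) (1≤threshold p))
    ...   | no  p≰ with p ≤? v
    ...     | yes p≤v = stagePt v v<U , slot-survives (toℕ-stagePt v<U) p≤v ,
              dist≤threshold p ≡client (kind-hubPt v<U free)
                (ℕ.≤-trans (D-client-ownHub≤ i v) (≤threshold (threshold-near i) (ℕ.≰⇒> p≰)))
    ...     | no  p≰v = lastHub , lastHub-survives p≤ ,
              dist≤threshold p ≡client kind-lastHub
                (ℕ.≤-trans (D-client-hub≤ i v _) (≤threshold (threshold-center (suc i)) (ℕ.≤-trans (s≤s ≤v) (ℕ.≰⇒> p≰v))))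

    dist-center≥level : ∀ {x y κ j} → kind x ≡ κ → kind y ≡ center j → level κ < 2 + j * 2 → 2 + j * 2 ≤ dist x y
    dist-center≥level {κ = κ} ≡κ ≡center lt =
      ≤-dist ≡κ ≡center (ℕ.≤-trans (ℕ.m≤n⊔m (level κ) _) (level-≤D (ℕ.<⇒≢ lt)))

    center-isolated : ∀ {g y i p} → kind g ≡ center i → toℕ g ≡ stageStart + (1 + i * 3) → Survivor p y → y ≢ g →
                      2 + i * 2 ≤ dist g y
    center-isolated ≡center _ (hub ≡hub _ _ _ _) _ = ≤-dist ≡center ≡hub (level-≤D λ ())
    center-isolated {i = i} ≡center g≡ (center {j} ≡center′ y≡ _ _) y≢g =
      ≤-dist ≡center ≡center′ (ℕ.≤-trans (ℕ.m≤m⊔n (2 + i * 2) (2 + j * 2)) (level-≤D levels-differ))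
      where
      levels-differ : 2 + i * 2 ≢ 2 + j * 2
      levels-differ 2i+2≡2j+2 = slots-differ y≡ g≡ y≢g
        (cong (λ m → 1 + m * 3) (sym (ℕ.*-cancelʳ-≡ i j 2 (ℕ.+-cancelˡ-≡ 2 _ _ 2i+2≡2j+2))))

    dist-client-hub≥ : ∀ {i u y w} (i<K : i < K) (u<U : u < U) → 3 + i * 3 ≤ u → centerAt K u ≡ nothing →
                 kind y ≡ hub w → w < U → w ≢ u → w ≢ nearSlot i → 4 + i * 2 ≤ dist (clientPt i u i<K u<U) y
    dist-client-hub≥ i<K u<U ≤u free ≡hub w<U w≢u w≢near =
      ≤-dist (kind-clientPt i<K u<U ≤u free) ≡hub (D-client-hub≥ w<U w≢u w≢near)

    dist-client-center≥ : ∀ {i u y j} (i<K : i < K) (u<U : u < U) → 3 + i * 3 ≤ u → centerAt K u ≡ nothing →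
                    kind y ≡ center j → i < j → 4 + i * 2 ≤ dist (clientPt i u i<K u<U) y
    dist-client-center≥ i<K u<U ≤u free ≡center i<j =
      ℕ.≤-trans (gadget-gap i<j) (dist-center≥level (kind-clientPt i<K u<U ≤u free) ≡center (ℕ.+-monoʳ-< 2 (ℕ.*-monoˡ-< 2 i<j)))

    hub₀ : Fin n
    hub₀ = stagePt 0 (s≤s z≤n)

    stranded : ∀ i → i ≤ K → ∃[ w ] (∀ y → stageStart + (1 + i * 3) ≤ toℕ y → 2 + i * 2 ≤ dist w y)
    stranded zero    _   = hub₀ , λ y ≤y → apart (survivor ≤y)
      where
      apart : ∀ {y} → Survivor 1 y → 2 ≤ dist hub₀ y
      apart (hub ≡hub _ 1≤u _ _)  = ≤-dist (kind-hubPt (s≤s z≤n) (centerAt-0 K)) ≡hub (D-hub-hub≥ (s≤s z≤n) (ℕ.<⇒≢ 1≤u))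
      apart (center ≡center _ _ _) =
        ℕ.≤-trans (ℕ.m≤m+n 2 _) (dist-center≥level (kind-hubPt (s≤s z≤n) (centerAt-0 K)) ≡center (s≤s z≤n))
    stranded (suc j) j<K = clientPt j (3 + j * 3) j<K last<U , λ y ≤y → apart (survivor ≤y)
      where
      last<U : 3 + j * 3 < U
      last<U = slot<U z≤n j<K
      apart : ∀ {y} → Survivor (4 + j * 3) y → 4 + j * 2 ≤ dist (clientPt j (3 + j * 3) j<K last<U) y
      apart (hub ≡hub _ ≤u u<U _) =
        dist-client-hub≥ j<K last<U ℕ.≤-refl (centerAt-last K j) ≡hub u<U (ℕ.>⇒≢ ≤u) (ℕ.>⇒≢ (ℕ.<-trans (ℕ.n<1+n _) ≤u))
      apart (center {i} ≡center _ ≤slot _) =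
        dist-client-center≥ j<K last<U ℕ.≤-refl (centerAt-last K j) ≡center (slot-< j i (s≤s (s≤s z≤n)) ≤slot)

    separated-start : SeparatedFrom (stageStart + 0) 2
    separated-start g ≤g = g , λ y ≤y y≢g → apart (survivor ≤g) (survivor ≤y) y≢g
      where
      apart : ∀ {g y} → Survivor 0 g → Survivor 0 y → y ≢ g → 2 ≤ dist g y
      apart (hub ≡hub g≡ _ u<U _) (hub ≡hub′ y≡ _ _ _) y≢g =
        ≤-dist ≡hub ≡hub′ (D-hub-hub≥ u<U (slots-differ g≡ y≡ (λ g≡y → y≢g (sym g≡y))))
      apart (hub ≡hub _ _ _ _) (center ≡center _ _ _) _ = ℕ.≤-trans (ℕ.m≤m+n 2 _) (dist-center≥level ≡hub ≡center (s≤s z≤n))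
      apart (center ≡center g≡ _ _) y-surv y≢g = ℕ.≤-trans (ℕ.m≤m+n 2 _) (center-isolated ≡center g≡ y-surv y≢g)

    separated-center : ∀ {i} → i < K → SeparatedFrom (stageStart + (1 + i * 3)) (2 + i * 2)
    separated-center {i} i<K _ _ with w , w-far ← stranded i (ℕ.<⇒≤ i<K) = w , λ y ≤y _ → w-far y ≤y

    separated-near : ∀ {i} → i < K → SeparatedFrom (stageStart + nearSlot i) (3 + i * 2)
    separated-near {i} i<K g ≤g with survivor ≤g
    ... | center {j} ≡center g≡ ≤slot _ = g , λ y ≤y y≢g →
          ℕ.≤-trans (ℕ.≤-trans (ℕ.n≤1+n _) (gadget-gap (slot-< i j (s≤s (s≤s z≤n)) ≤slot)))
                    (center-isolated ≡center g≡ (survivor ≤y) y≢g)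
    ... | hub {u} ≡hub g≡ near≤u u<U free with u ℕ.≟ nearSlot i
    ...   | yes refl = centerPt i i<K , λ y ≤y y≢g → apart (survivor ≤y) y≢g
      where
      apart : ∀ {y} → Survivor (nearSlot i) y → y ≢ g → 3 + i * 2 ≤ dist (centerPt i i<K) y
      apart (hub ≡hub′ y≡ _ w<U _) y≢g = ≤-dist (kind-centerPt i<K) ≡hub′ (D-center-hub≥ w<U (slots-differ y≡ g≡ y≢g))
      apart (center {j} ≡center _ ≤slot _) _ =
        ℕ.≤-trans (ℕ.≤-trans (ℕ.n≤1+n _) (gadget-gap i<j))
                  (dist-center≥level (kind-centerPt i<K) ≡center (ℕ.+-monoʳ-< 2 (ℕ.*-monoˡ-< 2 i<j)))
        where i<j = slot-< i j (s≤s (s≤s z≤n)) ≤slot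
    ...   | no u≢near = clientPt i u i<K u<U , λ y ≤y y≢g → apart (survivor ≤y) y≢g
      where
      ≤u : 3 + i * 3 ≤ u
      ≤u = ℕ.≤∧≢⇒< near≤u (λ near≡u → u≢near (sym near≡u))
      apart : ∀ {y} → Survivor (nearSlot i) y → y ≢ g → 3 + i * 2 ≤ dist (clientPt i u i<K u<U) y
      apart (hub {w} ≡hub′ y≡ _ w<U _) y≢g with w ℕ.≟ nearSlot i
      ... | yes refl = ≤-dist (kind-clientPt i<K u<U ≤u free) ≡hub′ (D-client-nearHub≥ w<U (λ near≡u → u≢near (sym near≡u)))
      ... | no w≢near = ℕ.≤-trans (ℕ.n≤1+n _) (dist-client-hub≥ i<K u<U ≤u free ≡hub′ w<U (slots-differ y≡ g≡ y≢g) w≢near)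
      apart (center {j} ≡center _ ≤slot _) _ =
        ℕ.≤-trans (ℕ.n≤1+n _) (dist-client-center≥ i<K u<U ≤u free ≡center (slot-< i j (s≤s (s≤s z≤n)) ≤slot))

    separated-last : ∀ {i} → i < K → SeparatedFrom (stageStart + (3 + i * 3)) (4 + i * 2)
    separated-last {i} i<K g ≤g with survivor ≤g
    ... | center {j} ≡center g≡ ≤slot _ = g , λ y ≤y y≢g →
          ℕ.≤-trans (gadget-gap (slot-< i j (s≤s (s≤s z≤n)) ≤slot)) (center-isolated ≡center g≡ (survivor ≤y) y≢g)
    ... | hub {u} ≡hub g≡ ≤u u<U free = clientPt i u i<K u<U , λ y ≤y y≢g → apart (survivor ≤y) y≢g
      where
      apart : ∀ {y} → Survivor (3 + i * 3) y → y ≢ g → 4 + i * 2 ≤ dist (clientPt i u i<K u<U) y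
      apart (hub ≡hub′ y≡ ≤w w<U _) y≢g =
        dist-client-hub≥ i<K u<U ≤u free ≡hub′ w<U (slots-differ y≡ g≡ y≢g) (ℕ.>⇒≢ (ℕ.<-≤-trans (ℕ.n<1+n _) ≤w))
      apart (center {j} ≡center _ ≤slot _) _ = dist-client-center≥ i<K u<U ≤u free ≡center (slot-< i j (s≤s (s≤s z≤n)) ≤slot)

    data StagePos : ℕ → Set where
      start    : StagePos 0
      atCenter : ∀ {i} → i < K → StagePos (1 + i * 3)
      atNear   : ∀ {i} → i < K → StagePos (nearSlot i)
      atLast   : ∀ {i} → i < K → StagePos (3 + i * 3)

    stagePos : ∀ p → p < 1 + K * 3 → StagePos p
    stagePos zero    _  = start
    stagePos (suc p) lt with stagePos p (ℕ.<-trans (ℕ.n<1+n p) lt)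
    ... | start        = atCenter (ℕ.*-cancelʳ-< 3 0 K (ℕ.s≤s⁻¹ lt))
    ... | atCenter i<K = atNear i<K
    ... | atNear i<K   = atLast i<K
    ... | atLast {i} _ = atCenter (ℕ.*-cancelʳ-< 3 (suc i) K (ℕ.s≤s⁻¹ lt))

    stage-removable : ∀ p → p < 1 + K * 3 → Removable (stageStart + p)
    stage-removable p p<  = threshold (suc p) ,
      subst (λ t → ServedFrom t (threshold (suc p))) (ℕ.+-suc stageStart p) (served (suc p) p<) ,
      separated (stagePos p p<)
      where
      separated : ∀ {p} → StagePos p → SeparatedFrom (stageStart + p) (threshold (suc p))
      separated start            = separated-start
      separated (atCenter {i} i<K) = subst (SeparatedFrom _) (sym (threshold-near i)) (separated-center i<K)
      separated (atNear {i} i<K)   = subst (SeparatedFrom _) (sym (threshold-last i)) (separated-near i<K)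
      separated (atLast {i} i<K)   = subst (SeparatedFrom _) (sym (threshold-center (suc i))) (separated-last i<K)

    prune-removable : ∀ t → t < stageStart → Removable t
    prune-removable t t<S = 1 , served-after , λ g _ → g , λ y _ y≢g → 1≤dist (λ g≡y → y≢g (sym g≡y))
      where
      served-after : ServedFrom (suc t) 1
      served-after c with y , ≤y , dist≤1 ← served 0 z≤n c =
        y , ℕ.≤-trans t<S (ℕ.≤-trans (ℕ.m≤m+n stageStart 0) ≤y) , dist≤1

    removable : ∀ t → t < stageStart + (1 + K * 3) → Removable t
    removable t t<N with t <? stageStart
    ... | yes t<S = prune-removable t t<S
    ... | no  t≮S = subst Removable t≡ (stage-removable (t ∸ stageStart) (ℕ.+-cancelˡ-< stageStart _ _ (subst (_< _) (sym t≡) t<N)))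
      where
      t≡ : stageStart + (t ∸ stageStart) ≡ t
      t≡ = ℕ.m+[n∸m]≡n (ℕ.≮⇒≥ t≮S)

    k : ℕ
    k = 2 + K

    d : Fin n → Fin n → ℚ
    d x y = ℕtoℚ (dist x y)

    d-isMetric : IsMetric d
    d-isMetric = ℕtoℚ-isMetric dist-isPseudometric 1≤dist

    deletions : ℕ
    deletions = stageStart + (1 + K * 3)

    n≡deletions+k : n ≡ deletions + k
    n≡deletions+k = begin
      stageStart + (3 + K * 4)              ≡⟨ cong (λ m → stageStart + (3 + m)) (ℕ.*-suc K 3) ⟩
      stageStart + (3 + (K + K * 3))        ≡⟨ cong (λ m → stageStart + (3 + m)) (ℕ.+-comm K (K * 3)) ⟩
      stageStart + (1 + (2 + (K * 3 + K)))  ≡⟨ cong (λ m → stageStart + suc m) (trans (ℕ.+-suc (K * 3) (suc K))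
                                                                                        (cong suc (ℕ.+-suc (K * 3) K))) ⟨
      stageStart + ((1 + K * 3) + k)        ≡⟨ ℕ.+-assoc stageStart (1 + K * 3) k ⟨
      deletions + k                          ∎
      where open ≡-Reasoning

    output : Subset n
    output = from deletions

    output-run : ReverseGreedyOutput d k output
    output-run = subst (λ m → ReverseGreedyRun d m ⊤ output)
      (sym (trans (cong (_∸ k) n≡deletions+k) (ℕ.m+n∸n≡m deletions k)))
      (run-in-order (ℕ.+-monoʳ-≤ stageStart (ℕ.<⇒≤ (slot<U (s≤s z≤n) ℕ.≤-refl))) removable)

    cost-output : cost d output ≡ just (ℕtoℚ (2 + K * 2))
    cost-output with w , w-far ← stranded K ℕ.≤-refl =
      subst (λ θ → cost d output ≡ just (ℕtoℚ θ)) (threshold-center K)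
        (cost-from (served (1 + K * 3) ℕ.≤-refl) w (λ y ≤y → subst (_≤ dist w y) (sym (threshold-center K)) (w-far y ≤y)))

    basePt : Fin n
    basePt = Fin.zero

    centers : ∀ m → m ≤ K → Subset n
    centers zero    _   = ⊥
    centers (suc m) m<K = centers m (ℕ.<⇒≤ m<K) ∪ ⁅ centerPt m m<K ⁆

    ∣centers∣≤ : ∀ m (m≤K : m ≤ K) → ∣ centers m m≤K ∣ ≤ m
    ∣centers∣≤ zero    _   = ℕ.≤-reflexive (∣⊥∣≡0 n)
    ∣centers∣≤ (suc m) m<K = ℕ.≤-trans (∣p∪q∣≤∣p∣+∣q∣ (centers m (ℕ.<⇒≤ m<K)) ⁅ centerPt m m<K ⁆)
      (subst (∣ centers m (ℕ.<⇒≤ m<K) ∣ + ∣ ⁅ centerPt m m<K ⁆ ∣ ≤_) (ℕ.+-comm m 1)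
        (ℕ.+-mono-≤ (∣centers∣≤ m (ℕ.<⇒≤ m<K)) (ℕ.≤-reflexive (∣⁅x⁆∣≡1 (centerPt m m<K)))))

    centerPt∈centers : ∀ {i} m (m≤K : m ≤ K) (i<m : i < m) → centerPt i (ℕ.<-≤-trans i<m m≤K) ∈ centers m m≤K
    centerPt∈centers (suc m) m<K i<1+m with ℕ.m≤n⇒m<n∨m≡n (ℕ.s≤s⁻¹ i<1+m)
    ... | inj₁ i<m  = x∈p∪q⁺ (inj₁ (centerPt∈centers m (ℕ.<⇒≤ m<K) i<m))
    ... | inj₂ refl = x∈p∪q⁺ (inj₂ (x∈⁅x⁆ _))

    optimal : Subset n
    optimal = ⁅ basePt ⁆ ∪ centers K ℕ.≤-refl

    k<n : k < n
    k<n = subst (k <_) (sym n≡deletions+k) (ℕ.m<n+m k (s≤s z≤n))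

    ∣optimal∣≤k : ∣ optimal ∣ ≤ k
    ∣optimal∣≤k = ℕ.≤-trans (∣p∪q∣≤∣p∣+∣q∣ ⁅ basePt ⁆ (centers K ℕ.≤-refl))
      (ℕ.+-mono-≤ (ℕ.≤-reflexive (∣⁅x⁆∣≡1 basePt)) (ℕ.≤-trans (∣centers∣≤ K ℕ.≤-refl) (ℕ.n≤1+n K)))

    optimal-covers : Covers d optimal 1ℚ
    optimal-covers c with view (toℕ c) (Fin.toℕ<n c)
    ... | base ≡base _ = basePt , basePt∈ ,
          ℕtoℚ-mono-≤ (dist-≤ ≡base refl (D-self≤ base) ℕ.≤-refl)
      where basePt∈ = x∈p∪q⁺ (inj₁ (x∈⁅x⁆ basePt))
    ... | hub {u} ≡hub _ _ _ = basePt , basePt∈ ,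
          ℕtoℚ-mono-≤ (dist-≤ ≡hub refl (subst (_≤ 1) (D-sym D-isPseudometric base (hub u)) (D-base-hub≤ u)) ℕ.≤-refl)
      where basePt∈ = x∈p∪q⁺ (inj₁ (x∈⁅x⁆ basePt))
    ... | center {i} ≡center _ i<K = centerPt i i<K , x∈p∪q⁺ (inj₂ (centerPt∈centers K ℕ.≤-refl i<K)) ,
          ℕtoℚ-mono-≤ (dist-≤ ≡center (kind-centerPt i<K) (D-self≤ (center i)) ℕ.≤-refl)
    ... | client {i} {v} ≡client _ i<K _ _ _ = centerPt i i<K , x∈p∪q⁺ (inj₂ (centerPt∈centers K ℕ.≤-refl i<K)) ,
          ℕtoℚ-mono-≤ (dist-≤ ≡client (kind-centerPt i<K) (D-client-center≤ i v) ℕ.≤-refl)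

    1≤cost : ∀ G → ∣ G ∣ < n → just 1ℚ ≤∞ cost d G
    1≤cost G ∣G∣<n with x , x∉G ← ∣p∣<n⇒∃∉ ∣G∣<n =
      cost≥ d x λ f f∈G → ℕtoℚ-mono-≤ (1≤dist λ x≡f → x∉G (subst (_∈ G) (sym x≡f) f∈G))

    optimal-isOPT : IsOPT d k 1ℚ
    optimal-isOPT = (optimal , ∣optimal∣≤k , cost-optimal) , λ G ∣G∣≤k → 1≤cost G (ℕ.≤-<-trans ∣G∣≤k k<n)
      where
      cost-optimal : cost d optimal ≡ just 1ℚ
      cost-optimal with x , x∉O ← ∣p∣<n⇒∃∉ (ℕ.≤-<-trans ∣optimal∣≤k k<n) =
        cost≡ d (0≤ℕtoℚ 1) optimal-covers x λ f f∈O →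
          ℕtoℚ-mono-≤ (1≤dist λ x≡f → x∉O (subst (_∈ optimal) (sym x≡f) f∈O))

  reverseGreedy≡[2k∸2]·OPT-instance : ∀ k → 1 ≤ k →
    Σ ℕ λ n → k ≤ n × Σ (Fin n → Fin n → ℚ) λ d → IsMetric d ×
      Σ (Subset n) λ G → ReverseGreedyOutput d k G ×
      Σ ℚ λ r → IsOPT d k r × (2 ≤ k → 0ℚ ℚ.< r) × cost d G ≡ just (ℕtoℚ (2 * k ∸ 2) ℚ.* r)
  reverseGreedy≡[2k∸2]·OPT-instance 1 _ =
    1 , ℕ.≤-refl , d , d-isMetric , ⊤ , done , 0ℚ ,
    ((⊤ , ℕ.≤-reflexive (∣⊤∣≡n 1) , cost-⊤) , λ G _ → 0≤cost d G) , (λ { (s≤s ()) }) ,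
    trans cost-⊤ (cong just (sym (ℚ.*-zeroˡ 0ℚ)))
    where
    d : Fin 1 → Fin 1 → ℚ
    d _ _ = 0ℚ
    d-isMetric : IsMetric d
    d-isMetric = ℕtoℚ-isMetric {D = λ _ _ → 0} (record { D-refl = λ _ → refl ; D-sym = λ _ _ → refl ; D-triangle = λ _ _ _ → z≤n })
                   λ { {zero} {zero} 0≢0 → ⊥-elim (0≢0 refl) }
    cost-⊤ : cost d ⊤ ≡ just 0ℚ
    cost-⊤ = cost≡ d ℚ.≤-refl (λ c → c , ∈⊤ , ℚ.≤-refl) zero λ _ _ → ℚ.≤-refl
  reverseGreedy≡[2k∸2]·OPT-instance (suc (suc K)) _ =
    n , ℕ.<⇒≤ k<n , d , d-isMetric , output , output-run , 1ℚ , optimal-isOPT , (λ _ → ℚ.positive⁻¹ 1ℚ) ,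
    trans cost-output (cong just (trans (cong ℕtoℚ (cong (_∸ 2) (ℕ.*-comm (2 + K) 2))) (sym (ℚ.*-identityʳ _))))
    where open Construction K

open import Data.Nat using (ℕ; _≤_; _*_; _∸_)
open import Data.Rational using (ℚ; 0ℚ; _<_) renaming (_*_ to _*ℚ_)
open import Data.Fin using (Fin)
open import Data.Fin.Subset using (Subset)
open import Data.Product using (Σ; _×_; _,_)
open import Data.Maybe using (just)
open import Relation.Binary.PropositionalEquality using (_≡_)

theorem1 : (k : ℕ) → 1 ≤ k →
  ((n : ℕ) → k ≤ n → (d : Fin n → Fin n → ℚ) → IsMetric d →
    (G : Subset n) → ReverseGreedyOutput d k G →
    (r : ℚ) → IsOPT d k r → cost d G ≤∞ just (ℕtoℚ (2 * k) *ℚ r))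
  ×
  (Σ ℕ λ n → k ≤ n × Σ (Fin n → Fin n → ℚ) λ d → IsMetric d ×
    Σ (Subset n) λ G → ReverseGreedyOutput d k G ×
    Σ ℚ λ r → IsOPT d k r × (2 ≤ k → 0ℚ < r) ×
      cost d G ≡ just (ℕtoℚ (2 * k ∸ 2) *ℚ r))
theorem1 k 1≤k = ReverseGreedy.reverseGreedy≤2k·OPT k 1≤k , ReverseGreedy.reverseGreedy≡[2k∸2]·OPT-instance k 1≤k
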